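{- For every integer $k\ge1$, \begin{align*} &\sum_{n_k\ge n_{k-1}\ge \dots \ge n_1 \ge 1} \frac{(q^2;q^2)_{n_1}\,q^{2n_1+2n_2+\dots+2n_k}}{(-q;q^2)_{n_1}(1-q^{2n_k})^2(1-q^{2n_{k-1}})^2\cdots(1-q^{2n_1})^2}\\ &=\sum_{n_k\ge n_{k-1}\ge \dots \ge n_1 \ge 1} \frac{q^{2n_1+2n_2+\dots+2n_k}}{(1-q^{2n_k})^2(1-q^{2n_{k-1}})^2\cdots(1-q^{2n_1})^2} +\sum_{n=1}^\infty \frac{(-1)^{n}q^{n(2n-1)+2kn}(1+q^{2n})}{(1-q^{2n})^{2k}}, \end{align*} as formal power series in $q$, where the multiple sums run over integers $n_1,\dots,n_k$.
   Context: Notation: $(a;q)_n=\prod_{j=0}^{n-1}(1-aq^j)$. -}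

module Defs where

open import Data.Nat as ℕ using (ℕ; zero; suc; _∸_; _≡ᵇ_)
open import Data.Integer as ℤ using (ℤ; +_; -_)
open import Data.Bool using (if_then_else_)
open import Data.List using (List; []; _∷_; map; foldr; upTo; zipWith; concatMap)

Series : Set
Series = ℕ → ℤ

sumℤ : List ℤ → ℤ
sumℤ = foldr ℤ._+_ (+ 0)

0ˢ : Series
0ˢ _ = + 0

1ˢ : Series
1ˢ zero    = + 1
1ˢ (suc _) = + 0

X^ : ℕ → Series
X^ m n = if n ≡ᵇ m then + 1 else + 0

infixl 6 _+ˢ_ _-ˢ_
infixl 7 _*ˢ_ _/ˢ_

_+ˢ_ : Series → Series → Series
(a +ˢ b) n = a n ℤ.+ b n

negˢ : Series → Series
negˢ a n = - a n

_-ˢ_ : Series → Series → Series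
a -ˢ b = a +ˢ negˢ b

_*ˢ_ : Series → Series → Series
(a *ˢ b) n = sumℤ (map (λ i → a i ℤ.* b (n ∸ i)) (upTo (suc n)))

powˢ : Series → ℕ → Series
powˢ a zero    = 1ˢ
powˢ a (suc n) = a *ˢ powˢ a n

prodˢ : List Series → Series
prodˢ = foldr _*ˢ_ 1ˢ

-- Multiplicative inverse of a series with constant term 1
-- (all denominators in the statement have constant term 1).
-- invCoeffs a n = [b_n, b_{n-1}, ..., b_0] where b = a⁻¹, i.e.
-- b_0 = 1,  b_{n+1} = - Σ_{i=1}^{n+1} a_i b_{n+1-i}.
invCoeffs : Series → ℕ → List ℤ
invCoeffs a zero    = + 1 ∷ []
invCoeffs a (suc n) =
  let bs = invCoeffs a n in
  (- sumℤ (zipWith (λ i b → a (suc i) ℤ.* b) (upTo (suc n)) bs)) ∷ bs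

headOr0 : List ℤ → ℤ
headOr0 []      = + 0
headOr0 (x ∷ _) = x

invˢ : Series → Series
invˢ a n = headOr0 (invCoeffs a n)

_/ˢ_ : Series → Series → Series
a /ˢ b = a *ˢ invˢ b

poch : Series → Series → ℕ → Series
poch a q n = prodˢ (map (λ j → 1ˢ -ˢ a *ˢ powˢ q j) (upTo n))

range : ℕ → ℕ → List ℕ
range lo hi = map (lo ℕ.+_) (upTo (suc hi ∸ lo))

-- all weakly increasing lists [n_1, ..., n_k] with lo ≤ n_1 ≤ ... ≤ n_k ≤ hi
chains : ℕ → ℕ → ℕ → List (List ℕ)
chains zero    lo hi = [] ∷ []
chains (suc k) lo hi = concatMap (λ m → map (m ∷_) (chains k m hi)) (range lo hi)

-- The coefficient
-- of q^N only takes the tuples with n_k ≤ N; this is exact for the families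
-- below, whose term for [n_1,...,n_k] has q-adic valuation ≥ 2 n_k > n_k.
chainSum : (List ℕ → Series) → ℕ → Series
chainSum f k N = sumℤ (map (λ t → f t N) (chains k 1 N))

-- Σ_{n ≥ 1} f n, coefficientwise; exact for families where f n has
-- q-adic valuation > N whenever n > N (true for the family below).
sum≥1 : (ℕ → Series) → Series
sum≥1 f N = sumℤ (map (λ n → f n N) (range 1 N))

q : Series
q = X^ 1

q² : Series
q² = X^ 2

g : ℕ → Series
g n = X^ (2 ℕ.* n) /ˢ powˢ (1ˢ -ˢ X^ (2 ℕ.* n)) 2

prodG : List ℕ → Series
prodG ns = prodˢ (map g ns)

lhsTerm : List ℕ → Series
lhsTerm []         = prodG []
lhsTerm (n₁ ∷ ns) = (poch q² q² n₁ /ˢ poch (negˢ q) q² n₁) *ˢ prodG (n₁ ∷ ns)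

rhsTerm : ℕ → ℕ → Series
rhsTerm k n =
  (powˢ (negˢ 1ˢ) n *ˢ X^ (n ℕ.* (2 ℕ.* n ∸ 1) ℕ.+ 2 ℕ.* k ℕ.* n) *ˢ (1ˢ +ˢ X^ (2 ℕ.* n)))
    /ˢ powˢ (1ˢ -ˢ X^ (2 ℕ.* n)) (2 ℕ.* k)

-- Write pochRatio m = (q²;q²)_m / (-q;q²)_m and g n = q^{2n} / (1-q^{2n})².  The
-- left-hand side is the chain sum of pochRatio n₁ ∏ᵢ g nᵢ, so it is the chain sum of
-- the right-hand side plus the excess Σ (pochRatio n₁ - 1) ∏ᵢ g nᵢ.  The finite expansion
--   pochRatio M = 1 + Σ_{1 ≤ j ≤ M} weight j M,
--   weight j M  = (-1)ʲ q^{j(2j-1)} (1+q^{2j}) (q²;q²)_M² / ((q²;q²)_{M-j} (q²;q²)_{M+j}),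
-- proved by induction on M with a telescoping sum, and the relation
-- weight j (M+1) (g j - g (M+1)) = weight j M · g j give the excess truncated at M in the
-- closed form Σ_{j ≤ M} weight j M (g j)ᵏ.  As weight j M ≡ limitWeight j modulo
-- q^{2(M-j+1)} and q^{2j} divides g j, the coefficient of q^N only sees
-- Σ_j limitWeight j (g j)ᵏ, the single sum of the statement.
module Submission where

open import Defs
open import Data.Nat using (ℕ; zero; suc; _+_; _*_; _∸_; _≤_; _<_; z≤n; s≤s; _<?_)
import Data.Nat.Properties as ℕP
import Data.Nat.Tactic.RingSolver as ℕSolver
open import Data.Integer as ℤ using (ℤ; +_; -_) renaming (_+_ to _+ℤ_; _*_ to _*ℤ_)
import Data.Integer.Properties as ℤP
import Data.Integer.Tactic.RingSolver as ℤSolver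
open import Data.Bool using (Bool; T)
open import Data.List using (List; []; _∷_; map; foldr; upTo; applyUpTo; zipWith; _++_; concat; concatMap)
import Data.List.Properties as ListP
open import Data.Maybe using (nothing)
open import Data.Product using (_×_; _,_)
open import Data.Vec using (Vec)
open import Function using (_∘_)
open import Level using (0ℓ)
open import Relation.Nullary using (does; yes; no)
open import Relation.Binary.PropositionalEquality using (_≡_; refl; sym; trans; cong; cong₂; subst; module ≡-Reasoning)
open import Algebra.Bundles using (CommutativeRing)
open import Algebra.Structures using (IsCommutativeRing)
import Algebra.Construct.Pointwise as Pointwise
import Relation.Binary.Reasoning.Setoid as SetoidReasoning

infix 4 _≈_
_≈_ : Series → Series → Set
a ≈ b = ∀ n → a n ≡ b n

Σℤ : (ℕ → ℤ) → ℕ → ℤ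
Σℤ f zero    = + 0
Σℤ f (suc n) = f 0 +ℤ Σℤ (f ∘ suc) n

sumℤ-applyUpTo : ∀ (f : ℕ → ℤ) g n → sumℤ (map f (applyUpTo g n)) ≡ Σℤ (f ∘ g) n
sumℤ-applyUpTo f g zero    = refl
sumℤ-applyUpTo f g (suc n) = cong (f (g 0) +ℤ_) (sumℤ-applyUpTo f (g ∘ suc) n)

Σℤ-cong : ∀ {f h} n → (∀ i → f i ≡ h i) → Σℤ f n ≡ Σℤ h n
Σℤ-cong zero    e = refl
Σℤ-cong (suc n) e = cong₂ _+ℤ_ (e 0) (Σℤ-cong n (e ∘ suc))

Σℤ-+ : ∀ f h n → Σℤ (λ i → f i +ℤ h i) n ≡ Σℤ f n +ℤ Σℤ h n
Σℤ-+ f h zero    = refl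
Σℤ-+ f h (suc n) = trans (cong ((f 0 +ℤ h 0) +ℤ_) (Σℤ-+ (f ∘ suc) (h ∘ suc) n))
  (interchange (f 0) (h 0) (Σℤ (f ∘ suc) n) (Σℤ (h ∘ suc) n))
  where
  interchange : ∀ a b c d → (a +ℤ b) +ℤ (c +ℤ d) ≡ (a +ℤ c) +ℤ (b +ℤ d)
  interchange = ℤSolver.solve-∀

Σℤ-scale : ∀ c f n → Σℤ (λ i → c *ℤ f i) n ≡ c *ℤ Σℤ f n
Σℤ-scale c f zero    = sym (ℤP.*-zeroʳ c)
Σℤ-scale c f (suc n) = trans (cong (c *ℤ f 0 +ℤ_) (Σℤ-scale c (f ∘ suc) n))
  (sym (ℤP.*-distribˡ-+ c (f 0) (Σℤ (f ∘ suc) n)))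

Σℤ-neg : ∀ f n → Σℤ (λ i → - f i) n ≡ - Σℤ f n
Σℤ-neg f zero    = refl
Σℤ-neg f (suc n) = trans (cong (- f 0 +ℤ_) (Σℤ-neg (f ∘ suc) n))
  (sym (ℤP.neg-distrib-+ (f 0) (Σℤ (f ∘ suc) n)))

Σℤ-zero : ∀ f n → (∀ i → i < n → f i ≡ + 0) → Σℤ f n ≡ + 0
Σℤ-zero f zero    e = refl
Σℤ-zero f (suc n) e = cong₂ _+ℤ_ (e 0 (s≤s z≤n)) (Σℤ-zero (f ∘ suc) n (λ i i<n → e (suc i) (s≤s i<n)))

*ˢ-coeff : ∀ a b n → (a *ˢ b) n ≡ Σℤ (λ i → a i *ℤ b (n ∸ i)) (suc n)
*ˢ-coeff a b n = sumℤ-applyUpTo (λ i → a i *ℤ b (n ∸ i)) (λ i → i) (suc n)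

-- shift a = (a - a₀)/q.  Products are analysed by peeling off the constant term.
shift : Series → Series
shift a n = a (suc n)

*ˢ-coeff₀ : ∀ a b → (a *ˢ b) 0 ≡ a 0 *ℤ b 0
*ˢ-coeff₀ a b = trans (*ˢ-coeff a b 0) (ℤP.+-identityʳ _)

*ˢ-coeffSuc : ∀ a b n → (a *ˢ b) (suc n) ≡ a 0 *ℤ b (suc n) +ℤ (shift a *ˢ b) n
*ˢ-coeffSuc a b n = trans (*ˢ-coeff a b (suc n)) (cong (a 0 *ℤ b (suc n) +ℤ_) (sym (*ˢ-coeff (shift a) b n)))

infixl 7 _·ˢ_
_·ˢ_ : ℤ → Series → Series
(c ·ˢ a) n = c *ℤ a n

*ˢ-cong : ∀ {a a′ b b′} → a ≈ a′ → b ≈ b′ → (a *ˢ b) ≈ (a′ *ˢ b′)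
*ˢ-cong {a} {a′} {b} {b′} e f n = trans (*ˢ-coeff a b n) (trans
  (Σℤ-cong {λ i → a i *ℤ b (n ∸ i)} {λ i → a′ i *ℤ b′ (n ∸ i)} (suc n) (λ i → cong₂ _*ℤ_ (e i) (f (n ∸ i))))
  (sym (*ˢ-coeff a′ b′ n)))

*ˢ-distribʳ : ∀ a b c → ((a +ˢ b) *ˢ c) ≈ (a *ˢ c +ˢ b *ˢ c)
*ˢ-distribʳ a b c n = trans (*ˢ-coeff (a +ˢ b) c n) (trans
  (Σℤ-cong {λ i → (a i +ℤ b i) *ℤ c (n ∸ i)} {λ i → a i *ℤ c (n ∸ i) +ℤ b i *ℤ c (n ∸ i)} (suc n)
     (λ i → ℤP.*-distribʳ-+ (c (n ∸ i)) (a i) (b i)))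
  (trans (Σℤ-+ (λ i → a i *ℤ c (n ∸ i)) (λ i → b i *ℤ c (n ∸ i)) (suc n))
         (sym (cong₂ _+ℤ_ (*ˢ-coeff a c n) (*ˢ-coeff b c n)))))

*ˢ-scaleˡ : ∀ c a b → ((c ·ˢ a) *ˢ b) ≈ (c ·ˢ (a *ˢ b))
*ˢ-scaleˡ c a b n = trans (*ˢ-coeff (c ·ˢ a) b n) (trans
  (Σℤ-cong {λ i → c *ℤ a i *ℤ b (n ∸ i)} {λ i → c *ℤ (a i *ℤ b (n ∸ i))} (suc n)
     (λ i → ℤP.*-assoc c (a i) (b (n ∸ i))))
  (trans (Σℤ-scale c (λ i → a i *ℤ b (n ∸ i)) (suc n)) (cong (c *ℤ_) (sym (*ˢ-coeff a b n)))))

*ˢ-negˡ : ∀ a b → (negˢ a *ˢ b) ≈ negˢ (a *ˢ b)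
*ˢ-negˡ a b n = trans (*ˢ-coeff (negˢ a) b n) (trans
  (Σℤ-cong {λ i → (- a i) *ℤ b (n ∸ i)} {λ i → - (a i *ℤ b (n ∸ i))} (suc n)
     (λ i → sym (ℤP.neg-distribˡ-* (a i) (b (n ∸ i)))))
  (trans (Σℤ-neg (λ i → a i *ℤ b (n ∸ i)) (suc n)) (cong -_ (sym (*ˢ-coeff a b n)))))

*ˢ-zeroˡ : ∀ a b → (∀ i → a i ≡ + 0) → (a *ˢ b) ≈ 0ˢ
*ˢ-zeroˡ a b e n = trans (*ˢ-coeff a b n)
  (Σℤ-zero (λ i → a i *ℤ b (n ∸ i)) (suc n) (λ i _ → cong (_*ℤ b (n ∸ i)) (e i)))

-- Commutativity, by simultaneous induction on the coefficient index: the
-- auxiliary statement swaps the roles of the two constant terms.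
mutual
  *ˢ-comm : ∀ n a b → (a *ˢ b) n ≡ (b *ˢ a) n
  *ˢ-comm zero a b = trans (*ˢ-coeff₀ a b) (trans (ℤP.*-comm (a 0) (b 0)) (sym (*ˢ-coeff₀ b a)))
  *ˢ-comm (suc n) a b = begin
      (a *ˢ b) (suc n)                       ≡⟨ *ˢ-coeffSuc a b n ⟩
      a 0 *ℤ b (suc n) +ℤ (shift a *ˢ b) n   ≡⟨ cong (a 0 *ℤ b (suc n) +ℤ_) (*ˢ-comm n (shift a) b) ⟩
      a 0 *ℤ b (suc n) +ℤ (b *ˢ shift a) n   ≡⟨ *ˢ-comm-swap n a b ⟩
      b 0 *ℤ a (suc n) +ℤ (a *ˢ shift b) n   ≡⟨ cong (b 0 *ℤ a (suc n) +ℤ_) (*ˢ-comm n a (shift b)) ⟩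
      b 0 *ℤ a (suc n) +ℤ (shift b *ˢ a) n   ≡⟨ sym (*ˢ-coeffSuc b a n) ⟩
      (b *ˢ a) (suc n)                       ∎
    where open ≡-Reasoning

  *ˢ-comm-swap : ∀ n a b → a 0 *ℤ b (suc n) +ℤ (b *ˢ shift a) n ≡ b 0 *ℤ a (suc n) +ℤ (a *ˢ shift b) n
  *ˢ-comm-swap zero a b = trans (cong (a 0 *ℤ b 1 +ℤ_) (*ˢ-coeff₀ b (shift a)))
    (trans (ℤP.+-comm (a 0 *ℤ b 1) (b 0 *ℤ a 1)) (cong (b 0 *ℤ a 1 +ℤ_) (sym (*ˢ-coeff₀ a (shift b)))))
  *ˢ-comm-swap (suc m) a b = begin
      x +ℤ (b *ˢ shift a) (suc m)                     ≡⟨ cong (x +ℤ_) (*ˢ-coeffSuc b (shift a) m) ⟩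
      x +ℤ (y +ℤ (shift b *ˢ shift a) m)              ≡⟨ cong (λ z → x +ℤ (y +ℤ z)) (*ˢ-comm m (shift b) (shift a)) ⟩
      x +ℤ (y +ℤ (shift a *ˢ shift b) m)              ≡⟨ exchange x y ((shift a *ˢ shift b) m) ⟩
      y +ℤ (x +ℤ (shift a *ˢ shift b) m)              ≡⟨ cong (y +ℤ_) (sym (*ˢ-coeffSuc a (shift b) m)) ⟩
      y +ℤ (a *ˢ shift b) (suc m)                     ∎
    where
    open ≡-Reasoning
    x y : ℤ
    x = a 0 *ℤ b (suc (suc m))
    y = b 0 *ℤ a (suc (suc m))
    exchange : ∀ x y z → x +ℤ (y +ℤ z) ≡ y +ℤ (x +ℤ z)
    exchange = ℤSolver.solve-∀

*ˢ-assoc : ∀ n a b c → ((a *ˢ b) *ˢ c) n ≡ (a *ˢ (b *ˢ c)) n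
*ˢ-assoc zero a b c = trans (*ˢ-coeff₀ (a *ˢ b) c) (trans (cong (_*ℤ c 0) (*ˢ-coeff₀ a b))
  (trans (ℤP.*-assoc (a 0) (b 0) (c 0)) (trans (cong (a 0 *ℤ_) (sym (*ˢ-coeff₀ b c))) (sym (*ˢ-coeff₀ a (b *ˢ c))))))
*ˢ-assoc (suc n) a b c = begin
    ((a *ˢ b) *ˢ c) (suc n)
      ≡⟨ *ˢ-coeffSuc (a *ˢ b) c n ⟩
    (a *ˢ b) 0 *ℤ c (suc n) +ℤ (shift (a *ˢ b) *ˢ c) n
      ≡⟨ cong₂ _+ℤ_ (cong (_*ℤ c (suc n)) (*ˢ-coeff₀ a b)) (*ˢ-cong {b = c} {b′ = c} (*ˢ-coeffSuc a b) (λ _ → refl) n) ⟩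
    a 0 *ℤ b 0 *ℤ c (suc n) +ℤ ((a 0 ·ˢ shift b +ˢ shift a *ˢ b) *ˢ c) n
      ≡⟨ cong (a 0 *ℤ b 0 *ℤ c (suc n) +ℤ_) (trans (*ˢ-distribʳ (a 0 ·ˢ shift b) (shift a *ˢ b) c n)
           (cong₂ _+ℤ_ (*ˢ-scaleˡ (a 0) (shift b) c n) (*ˢ-assoc n (shift a) b c))) ⟩
    a 0 *ℤ b 0 *ℤ c (suc n) +ℤ (a 0 *ℤ (shift b *ˢ c) n +ℤ (shift a *ˢ (b *ˢ c)) n)
      ≡⟨ regroup (a 0) (b 0) (c (suc n)) ((shift b *ˢ c) n) ((shift a *ˢ (b *ˢ c)) n) ⟩
    a 0 *ℤ (b 0 *ℤ c (suc n) +ℤ (shift b *ˢ c) n) +ℤ (shift a *ˢ (b *ˢ c)) n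
      ≡⟨ cong (λ z → a 0 *ℤ z +ℤ (shift a *ˢ (b *ˢ c)) n) (sym (*ˢ-coeffSuc b c n)) ⟩
    a 0 *ℤ (b *ˢ c) (suc n) +ℤ (shift a *ˢ (b *ˢ c)) n
      ≡⟨ sym (*ˢ-coeffSuc a (b *ˢ c) n) ⟩
    (a *ˢ (b *ˢ c)) (suc n) ∎
  where
  open ≡-Reasoning
  regroup : ∀ x y z u v → x *ℤ y *ℤ z +ℤ (x *ℤ u +ℤ v) ≡ x *ℤ (y *ℤ z +ℤ u) +ℤ v
  regroup = ℤSolver.solve-∀

-- 1ˢ is a left unit: its shift is zero.
*ˢ-identityˡ : ∀ a → (1ˢ *ˢ a) ≈ a
*ˢ-identityˡ a zero    = trans (*ˢ-coeff₀ 1ˢ a) (ℤP.*-identityˡ (a 0))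
*ˢ-identityˡ a (suc n) = trans (*ˢ-coeffSuc 1ˢ a n)
  (trans (cong (1ˢ 0 *ℤ a (suc n) +ℤ_) (*ˢ-zeroˡ (shift 1ˢ) a (λ _ → refl) n))
  (trans (ℤP.+-identityʳ _) (ℤP.*-identityˡ (a (suc n)))))

seriesIsCommutativeRing : IsCommutativeRing _≈_ _+ˢ_ _*ˢ_ negˢ 0ˢ 1ˢ
seriesIsCommutativeRing = record
  { isRing = record
    { +-isAbelianGroup = Pointwise.isAbelianGroup ℕ ℤP.+-0-isAbelianGroup
    ; *-cong     = *ˢ-cong
    ; *-assoc    = λ a b c n → *ˢ-assoc n a b c
    ; *-identity = *ˢ-identityˡ , (λ a n → trans (*ˢ-comm n a 1ˢ) (*ˢ-identityˡ a n))
    ; distrib    = (λ a b c n → trans (*ˢ-comm n a (b +ˢ c))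
                      (trans (*ˢ-distribʳ b c a n) (cong₂ _+ℤ_ (*ˢ-comm n b a) (*ˢ-comm n c a))))
                 , (λ a b c n → *ˢ-distribʳ b c a n)
    }
  ; *-comm = λ a b n → *ˢ-comm n a b
  }

seriesRing : CommutativeRing 0ℓ 0ℓ
seriesRing = record { isCommutativeRing = seriesIsCommutativeRing }

open CommutativeRing seriesRing
  using (*-cong; +-cong; -‿cong; *-assoc; *-comm; *-identityˡ; *-identityʳ; +-assoc; +-identityˡ; +-identityʳ; distribˡ; zeroʳ; setoid)
  renaming (refl to ≈-refl; sym to ≈-sym; trans to ≈-trans; reflexive to ≈-reflexive)
module ≈-Reasoning = SetoidReasoning setoid

refl≈ : ∀ x → x ≈ x
refl≈ x = ≈-refl {x}

-- Integer constants as series.  The two special cases make constˢ 0 and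
-- constˢ 1 definitionally equal to 0ˢ and 1ˢ, which the solver needs.
constˢ′ : ℤ → Series
constˢ′ c zero    = c
constˢ′ c (suc _) = + 0

constˢ : ℤ → Series
constˢ (+ zero)     = 0ˢ
constˢ (+ suc zero) = 1ˢ
constˢ c            = constˢ′ c

constˢ≈constˢ′ : ∀ c → constˢ c ≈ constˢ′ c
constˢ≈constˢ′ (+ zero)         zero    = refl
constˢ≈constˢ′ (+ zero)         (suc n) = refl
constˢ≈constˢ′ (+ suc zero)     zero    = refl
constˢ≈constˢ′ (+ suc zero)     (suc n) = refl
constˢ≈constˢ′ (+ suc (suc k))  n       = refl
constˢ≈constˢ′ (ℤ.-[1+ k ])     n       = refl

constˢ-+ : ∀ a b → constˢ (a +ℤ b) ≈ (constˢ a +ˢ constˢ b)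
constˢ-+ a b n = trans (constˢ≈constˢ′ (a +ℤ b) n) (trans (pointwise n) (sym (cong₂ _+ℤ_ (constˢ≈constˢ′ a n) (constˢ≈constˢ′ b n))))
  where
  pointwise : ∀ n → constˢ′ (a +ℤ b) n ≡ (constˢ′ a +ˢ constˢ′ b) n
  pointwise zero    = refl
  pointwise (suc n) = refl

constˢ-* : ∀ a b → constˢ (a *ℤ b) ≈ (constˢ a *ˢ constˢ b)
constˢ-* a b n = trans (constˢ≈constˢ′ (a *ℤ b) n)
  (trans (pointwise n) (sym (*ˢ-cong (constˢ≈constˢ′ a) (constˢ≈constˢ′ b) n)))
  where
  pointwise : constˢ′ (a *ℤ b) ≈ (constˢ′ a *ˢ constˢ′ b)
  pointwise zero    = sym (*ˢ-coeff₀ (constˢ′ a) (constˢ′ b))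
  pointwise (suc n) = sym (trans (*ˢ-coeffSuc (constˢ′ a) (constˢ′ b) n)
    (cong₂ _+ℤ_ (ℤP.*-zeroʳ a) (*ˢ-zeroˡ (shift (constˢ′ a)) (constˢ′ b) (λ _ → refl) n)))

constˢ-neg : ∀ a → constˢ (- a) ≈ negˢ (constˢ a)
constˢ-neg a n = trans (constˢ≈constˢ′ (- a) n) (trans (pointwise n) (sym (cong -_ (constˢ≈constˢ′ a n))))
  where
  pointwise : ∀ n → constˢ′ (- a) n ≡ negˢ (constˢ′ a) n
  pointwise zero    = refl
  pointwise (suc n) = refl

-- The library's
-- non-reflective solver takes its coefficients from the carrier itself, where
-- zero tests are undecidable; here the library's sparse-polynomial normaliser
-- is instantiated with coefficients in ℤ and the homomorphism constˢ instead.
module SeriesSolver where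
  import Tactic.RingSolver.Core.AlmostCommutativeRing as ACR
  open import Tactic.RingSolver.Core.Polynomial.Parameters using (Homomorphism)
  open import Tactic.RingSolver.Core.Expression public

  seriesACR : ACR.AlmostCommutativeRing 0ℓ 0ℓ
  seriesACR = ACR.fromCommutativeRing seriesRing (λ _ → nothing)

  open ACR.AlmostCommutativeRing seriesACR using (rawRing; semiring)

  isZeroℤ : ℤ → Bool
  isZeroℤ z = does (z ℤ.≟ + 0)

  isZeroℤ-sound : ∀ x → T (isZeroℤ x) → 0ˢ ≈ constˢ x
  isZeroℤ-sound x t with x ℤ.≟ + 0
  isZeroℤ-sound .(+ 0) t | yes refl = λ _ → refl

  ℤ⟶series : Homomorphism 0ℓ 0ℓ 0ℓ 0ℓ
  ℤ⟶series = record
    { from          = record { rawRing = ℤ.+-*-rawRing ; isZero = isZeroℤ }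
    ; to            = seriesACR
    ; morphism      = record { ⟦_⟧ = constˢ ; +-homo = constˢ-+ ; *-homo = constˢ-* ; -‿homo = constˢ-neg
                             ; 0-homo = λ _ → refl ; 1-homo = λ _ → refl }
    ; Zero-C⟶Zero-R = isZeroℤ-sound
    }

  open Eval rawRing constˢ
  open import Tactic.RingSolver.Core.Polynomial.Base (Homomorphism.from ℤ⟶series)
  open import Algebra.Properties.Semiring.Exp.TCOptimised semiring using (^-congˡ)

  norm : ∀ {n} → Expr ℤ n → Poly n
  norm (Κ x)   = κ x
  norm (Ι x)   = ι x
  norm (x ⊕ y) = norm x ⊞ norm y
  norm (x ⊗ y) = norm x ⊠ norm y
  norm (⊝ x)   = ⊟ norm x
  norm (x ⊛ i) = norm x ⊡ i

  ⟦_⇓⟧ : ∀ {n} → Expr ℤ n → Vec Series n → Series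
  ⟦ expr ⇓⟧ = ⟦ norm expr ⟧ₚ
    where open import Tactic.RingSolver.Core.Polynomial.Semantics ℤ⟶series renaming (⟦_⟧ to ⟦_⟧ₚ)

  correct : ∀ {n} (expr : Expr ℤ n) ρ → ⟦ expr ⇓⟧ ρ ≈ ⟦ expr ⟧ ρ
  correct {n = n} = go
    where
    open import Tactic.RingSolver.Core.Polynomial.Homomorphism ℤ⟶series
    go : ∀ (expr : Expr ℤ n) ρ → ⟦ expr ⇓⟧ ρ ≈ ⟦ expr ⟧ ρ
    go (Κ x)   ρ = κ-hom x ρ
    go (Ι x)   ρ = ι-hom x ρ
    go (x ⊕ y) ρ = ≈-trans (⊞-hom (norm x) (norm y) ρ) (+-cong (go x ρ) (go y ρ))
    go (x ⊗ y) ρ = ≈-trans (⊠-hom (norm x) (norm y) ρ) (*-cong (go x ρ) (go y ρ))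
    go (⊝ x)   ρ = ≈-trans (⊟-hom (norm x) ρ) (-‿cong (go x ρ))
    go (x ⊛ i) ρ = ≈-trans (⊡-hom (norm x) i ρ) (^-congˡ i (go x ρ))

  open import Relation.Binary.Reflection setoid Ι ⟦_⟧ ⟦_⇓⟧ correct public using (solve)

  infix 4 _⊜_
  _⊜_ : ∀ {n} → Expr ℤ n → Expr ℤ n → Expr ℤ n × Expr ℤ n
  _⊜_ = _,_

  one : ∀ {n} → Expr ℤ n
  one = Κ (+ 1)

  infixl 6 _⊖_
  _⊖_ : ∀ {n} → Expr ℤ n → Expr ℤ n → Expr ℤ n
  a ⊖ b = a ⊕ (⊝ b)

open SeriesSolver using (solve; _⊜_; one; _⊖_; _⊕_; _⊗_; ⊝_; Κ)

-ˢ-cong : ∀ {a b c d} → a ≈ b → c ≈ d → (a -ˢ c) ≈ (b -ˢ d)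
-ˢ-cong e f n = cong₂ _+ℤ_ (e n) (cong -_ (f n))

≈-from-difference : ∀ a b → (a -ˢ b) ≈ 0ˢ → a ≈ b
≈-from-difference a b e = ≈-trans (solve 2 (λ a b → a ⊜ (a ⊖ b) ⊕ b) ≈-refl a b) (≈-trans (+-cong e (refl≈ b)) (+-identityˡ b))

ConstOne : Series → Set
ConstOne a = a 0 ≡ + 1

ConstOne-* : ∀ a b → ConstOne a → ConstOne b → ConstOne (a *ˢ b)
ConstOne-* a b ea eb = trans (*ˢ-coeff₀ a b) (cong₂ _*ℤ_ ea eb)

ConstOne-pow : ∀ a n → ConstOne a → ConstOne (powˢ a n)
ConstOne-pow a zero    e = refl
ConstOne-pow a (suc n) e = ConstOne-* a (powˢ a n) e (ConstOne-pow a n e)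

ConstOne-1- : ∀ x → x 0 ≡ + 0 → ConstOne (1ˢ -ˢ x)
ConstOne-1- x e = cong (λ z → + 1 +ℤ (- z)) e

NoConst-* : ∀ a b → a 0 ≡ + 0 → (a *ˢ b) 0 ≡ + 0
NoConst-* a b e = trans (*ˢ-coeff₀ a b) (trans (cong (_*ℤ b 0) e) (ℤP.*-zeroˡ (b 0)))

invCoeffs-sum : ∀ a m (f : ℕ → ℕ) →
  sumℤ (zipWith (λ i b → a (suc i) *ℤ b) (applyUpTo f (suc m)) (invCoeffs a m))
    ≡ Σℤ (λ i → a (suc (f i)) *ℤ invˢ a (m ∸ i)) (suc m)
invCoeffs-sum a zero    f = refl
invCoeffs-sum a (suc m) f = cong (a (suc (f 0)) *ℤ invˢ a (suc m) +ℤ_) (invCoeffs-sum a m (f ∘ suc))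

invˢ-suc : ∀ a n → invˢ a (suc n) ≡ - (shift a *ˢ invˢ a) n
invˢ-suc a n = cong -_ (trans (invCoeffs-sum a n (λ i → i)) (sym (*ˢ-coeff (shift a) (invˢ a) n)))

invˢ-inverseʳ : ∀ a → ConstOne a → (a *ˢ invˢ a) ≈ 1ˢ
invˢ-inverseʳ a e zero    = trans (*ˢ-coeff₀ a (invˢ a)) (cong (_*ℤ + 1) e)
invˢ-inverseʳ a e (suc n) = trans (*ˢ-coeffSuc a (invˢ a) n)
  (trans (cong (_+ℤ (shift a *ˢ invˢ a) n) (cong₂ _*ℤ_ e (invˢ-suc a n))) (cancels ((shift a *ˢ invˢ a) n)))
  where
  cancels : ∀ x → + 1 *ℤ (- x) +ℤ x ≡ + 0
  cancels = ℤSolver.solve-∀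

invˢ-unique : ∀ a c → ConstOne a → (a *ˢ c) ≈ 1ˢ → c ≈ invˢ a
invˢ-unique a c e h = begin
    c                   ≈⟨ ≈-sym (*-identityˡ c) ⟩
    1ˢ *ˢ c             ≈⟨ *-cong (≈-sym (invˢ-inverseʳ a e)) ≈-refl ⟩
    (a *ˢ invˢ a) *ˢ c  ≈⟨ *-cong (*-comm a (invˢ a)) ≈-refl ⟩
    (invˢ a *ˢ a) *ˢ c  ≈⟨ *-assoc (invˢ a) a c ⟩
    invˢ a *ˢ (a *ˢ c)  ≈⟨ *-cong (refl≈ (invˢ a)) h ⟩
    invˢ a *ˢ 1ˢ        ≈⟨ *-identityʳ (invˢ a) ⟩
    invˢ a              ∎
  where open ≈-Reasoning

invˢ-cong : ∀ a b → ConstOne a → a ≈ b → invˢ a ≈ invˢ b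
invˢ-cong a b e h = invˢ-unique b (invˢ a) (trans (sym (h 0)) e) (≈-trans (*-cong (≈-sym h) ≈-refl) (invˢ-inverseʳ a e))

invˢ-* : ∀ a b → ConstOne a → ConstOne b → invˢ (a *ˢ b) ≈ (invˢ a *ˢ invˢ b)
invˢ-* a b ea eb = ≈-sym (invˢ-unique (a *ˢ b) (invˢ a *ˢ invˢ b) (ConstOne-* a b ea eb) (begin
    (a *ˢ b) *ˢ (invˢ a *ˢ invˢ b)
      ≈⟨ solve 4 (λ a b c d → (a ⊗ b) ⊗ (c ⊗ d) ⊜ (a ⊗ c) ⊗ (b ⊗ d)) ≈-refl a b (invˢ a) (invˢ b) ⟩
    (a *ˢ invˢ a) *ˢ (b *ˢ invˢ b) ≈⟨ *-cong (invˢ-inverseʳ a ea) (invˢ-inverseʳ b eb) ⟩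
    1ˢ *ˢ 1ˢ                       ≈⟨ *-identityˡ 1ˢ ⟩
    1ˢ                             ∎))
  where open ≈-Reasoning

invˢ-1 : invˢ 1ˢ ≈ 1ˢ
invˢ-1 = ≈-sym (invˢ-unique 1ˢ 1ˢ refl (*-identityˡ 1ˢ))

cancel-ConstOne : ∀ x y p → ConstOne p → (x *ˢ p) ≈ (y *ˢ p) → x ≈ y
cancel-ConstOne x y p up e = begin
    x                   ≈⟨ ≈-sym (*-identityʳ x) ⟩
    x *ˢ 1ˢ             ≈⟨ *-cong (refl≈ x) (≈-sym (invˢ-inverseʳ p up)) ⟩
    x *ˢ (p *ˢ invˢ p)  ≈⟨ ≈-sym (*-assoc x p (invˢ p)) ⟩
    (x *ˢ p) *ˢ invˢ p  ≈⟨ *-cong e (refl≈ (invˢ p)) ⟩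
    (y *ˢ p) *ˢ invˢ p  ≈⟨ *-assoc y p (invˢ p) ⟩
    y *ˢ (p *ˢ invˢ p)  ≈⟨ *-cong (refl≈ y) (invˢ-inverseʳ p up) ⟩
    y *ˢ 1ˢ             ≈⟨ *-identityʳ y ⟩
    y                   ∎
  where open ≈-Reasoning

pow-cong : ∀ {x y} n → x ≈ y → powˢ x n ≈ powˢ y n
pow-cong zero    e = ≈-refl
pow-cong (suc n) e = *-cong e (pow-cong n e)

pow-+ : ∀ x a b → powˢ x (a + b) ≈ (powˢ x a *ˢ powˢ x b)
pow-+ x zero    b = ≈-sym (*-identityˡ (powˢ x b))
pow-+ x (suc a) b = ≈-trans (*-cong (refl≈ x) (pow-+ x a b)) (≈-sym (*-assoc x (powˢ x a) (powˢ x b)))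

pow-* : ∀ x a b → powˢ x (a * b) ≈ powˢ (powˢ x b) a
pow-* x zero    b = ≈-refl
pow-* x (suc a) b = ≈-trans (pow-+ x b (a * b)) (*-cong (refl≈ (powˢ x b)) (pow-* x a b))

pow-distrib : ∀ x y n → powˢ (x *ˢ y) n ≈ (powˢ x n *ˢ powˢ y n)
pow-distrib x y zero    = ≈-sym (*-identityˡ 1ˢ)
pow-distrib x y (suc n) = ≈-trans (*-cong (refl≈ (x *ˢ y)) (pow-distrib x y n))
  (solve 4 (λ a b c d → (a ⊗ b) ⊗ (c ⊗ d) ⊜ (a ⊗ c) ⊗ (b ⊗ d)) ≈-refl x y (powˢ x n) (powˢ y n))

invˢ-pow : ∀ x n → ConstOne x → invˢ (powˢ x n) ≈ powˢ (invˢ x) n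
invˢ-pow x zero    e = invˢ-1
invˢ-pow x (suc n) e = ≈-trans (invˢ-* x (powˢ x n) e (ConstOne-pow x n e)) (*-cong (refl≈ (invˢ x)) (invˢ-pow x n e))

X^-≡ : ∀ {a b} → a ≡ b → X^ a ≈ X^ b
X^-≡ refl = ≈-refl

X^0 : X^ 0 ≈ 1ˢ
X^0 zero    = refl
X^0 (suc n) = refl

X^-suc : ∀ a → X^ (suc a) ≈ (X^ 1 *ˢ X^ a)
X^-suc a zero    = sym (*ˢ-coeff₀ (X^ 1) (X^ a))
X^-suc a (suc n) = sym (trans (*ˢ-coeffSuc (X^ 1) (X^ a) n)
  (trans (cong (+ 0 *ℤ X^ a (suc n) +ℤ_) (trans (*ˢ-cong {b = X^ a} shift-X^1 (λ _ → refl) n) (*ˢ-identityˡ (X^ a) n)))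
         (ℤP.+-identityˡ (X^ a n))))
  where
  shift-X^1 : shift (X^ 1) ≈ 1ˢ
  shift-X^1 zero    = refl
  shift-X^1 (suc n) = refl

X^-+ : ∀ a b → X^ (a + b) ≈ (X^ a *ˢ X^ b)
X^-+ zero    b = ≈-trans (≈-sym (*-identityˡ (X^ b))) (*-cong (≈-sym X^0) (refl≈ (X^ b)))
X^-+ (suc a) b = ≈-trans (X^-suc (a + b)) (≈-trans (*-cong (refl≈ (X^ 1)) (X^-+ a b))
  (≈-trans (≈-sym (*-assoc (X^ 1) (X^ a) (X^ b))) (*-cong (≈-sym (X^-suc a)) (refl≈ (X^ b)))))

pow-X^ : ∀ a n → powˢ (X^ a) n ≈ X^ (n * a)
pow-X^ a zero    = ≈-sym X^0
pow-X^ a (suc n) = ≈-trans (*-cong (refl≈ (X^ a)) (pow-X^ a n)) (≈-sym (X^-+ a (n * a)))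

sumˢ : List Series → Series
sumˢ = foldr _+ˢ_ 0ˢ

sumℤ-coeff : ∀ {A : Set} (f : A → Series) L N → sumℤ (map (λ t → f t N) L) ≡ sumˢ (map f L) N
sumℤ-coeff f []      N = refl
sumℤ-coeff f (t ∷ L) N = cong (f t N +ℤ_) (sumℤ-coeff f L N)

sumˢ-++ : ∀ L L′ → sumˢ (L ++ L′) ≈ (sumˢ L +ˢ sumˢ L′)
sumˢ-++ []      L′ = ≈-sym (+-identityˡ (sumˢ L′))
sumˢ-++ (x ∷ L) L′ = ≈-trans (+-cong (refl≈ x) (sumˢ-++ L L′)) (≈-sym (+-assoc x (sumˢ L) (sumˢ L′)))

sumˢ-map-map : ∀ {A B : Set} (f : B → Series) (h : A → B) L → sumˢ (map f (map h L)) ≈ sumˢ (map (f ∘ h) L)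
sumˢ-map-map f h []      = ≈-refl
sumˢ-map-map f h (x ∷ L) = +-cong (refl≈ (f (h x))) (sumˢ-map-map f h L)

sumˢ-concatMap : ∀ {A B : Set} (f : B → Series) (φ : A → List B) (L : List A) →
  sumˢ (map f (concatMap φ L)) ≈ sumˢ (map (λ x → sumˢ (map f (φ x))) L)
sumˢ-concatMap f φ []      = ≈-refl
sumˢ-concatMap f φ (x ∷ L) = ≈-trans (≈-reflexive (cong sumˢ (ListP.map-++ f (φ x) (concat (map φ L)))))
  (≈-trans (sumˢ-++ (map f (φ x)) (map f (concat (map φ L)))) (+-cong (refl≈ (sumˢ (map f (φ x)))) (sumˢ-concatMap f φ L)))

sumˢ-cong : ∀ {A : Set} (f h : A → Series) L → (∀ x → f x ≈ h x) → sumˢ (map f L) ≈ sumˢ (map h L)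
sumˢ-cong f h []      e = ≈-refl
sumˢ-cong f h (x ∷ L) e = +-cong (e x) (sumˢ-cong f h L e)

sumˢ-scale : ∀ {A : Set} (c : Series) (f : A → Series) L → sumˢ (map (λ x → c *ˢ f x) L) ≈ (c *ˢ sumˢ (map f L))
sumˢ-scale c f []      = ≈-sym (zeroʳ c)
sumˢ-scale c f (x ∷ L) = ≈-trans (+-cong (refl≈ (c *ˢ f x)) (sumˢ-scale c f L)) (≈-sym (distribˡ c (f x) (sumˢ (map f L))))

sumˢ-+ : ∀ {A : Set} (f h : A → Series) L → sumˢ (map (λ x → f x +ˢ h x) L) ≈ (sumˢ (map f L) +ˢ sumˢ (map h L))
sumˢ-+ f h []      = ≈-sym (+-identityˡ 0ˢ)
sumˢ-+ f h (x ∷ L) = ≈-trans (+-cong (refl≈ (f x +ˢ h x)) (sumˢ-+ f h L))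
  (solve 4 (λ a b c d → (a ⊕ b) ⊕ (c ⊕ d) ⊜ (a ⊕ c) ⊕ (b ⊕ d)) ≈-refl (f x) (h x) (sumˢ (map f L)) (sumˢ (map h L)))

sumˢ-neg : ∀ {A : Set} (f : A → Series) L → sumˢ (map (λ x → negˢ (f x)) L) ≈ negˢ (sumˢ (map f L))
sumˢ-neg f []      = λ _ → refl
sumˢ-neg f (x ∷ L) = ≈-trans (+-cong (refl≈ (negˢ (f x))) (sumˢ-neg f L)) (λ n → sym (ℤP.neg-distrib-+ (f x n) (sumˢ (map f L) n)))

Σˢ : (ℕ → Series) → ℕ → Series
Σˢ f zero    = 0ˢ
Σˢ f (suc n) = f 0 +ˢ Σˢ (f ∘ suc) n

sumˢ-applyUpTo : ∀ (f : ℕ → Series) g n → sumˢ (map f (applyUpTo g n)) ≈ Σˢ (f ∘ g) n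
sumˢ-applyUpTo f g zero    = ≈-refl
sumˢ-applyUpTo f g (suc n) = +-cong (refl≈ (f (g 0))) (sumˢ-applyUpTo f (g ∘ suc) n)

Σˢ-snoc : ∀ f n → Σˢ f (suc n) ≈ (Σˢ f n +ˢ f n)
Σˢ-snoc f zero    = ≈-trans (+-identityʳ (f 0)) (≈-sym (+-identityˡ (f 0)))
Σˢ-snoc f (suc n) = ≈-trans (+-cong (refl≈ (f 0)) (Σˢ-snoc (f ∘ suc) n)) (≈-sym (+-assoc (f 0) (Σˢ (f ∘ suc) n) (f (suc n))))

Σˢ-cong : ∀ f h n → (∀ i → i < n → f i ≈ h i) → Σˢ f n ≈ Σˢ h n
Σˢ-cong f h zero    e = ≈-refl
Σˢ-cong f h (suc n) e = +-cong (e 0 (s≤s z≤n)) (Σˢ-cong (f ∘ suc) (h ∘ suc) n (λ i i<n → e (suc i) (s≤s i<n)))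

rangeSum : (ℕ → Series) → ℕ → ℕ → Series
rangeSum f lo hi = sumˢ (map f (range lo hi))

rangeSum-Σˢ : ∀ f lo hi → rangeSum f lo hi ≈ Σˢ (λ i → f (lo + i)) (suc hi ∸ lo)
rangeSum-Σˢ f lo hi = ≈-trans (sumˢ-map-map f (λ i → lo + i) (upTo (suc hi ∸ lo))) (sumˢ-applyUpTo (λ i → f (lo + i)) (λ i → i) (suc hi ∸ lo))

rangeSum-snoc : ∀ f lo hi → lo ≤ suc hi → rangeSum f lo (suc hi) ≈ (rangeSum f lo hi +ˢ f (suc hi))
rangeSum-snoc f lo hi le = begin
    rangeSum f lo (suc hi)                          ≈⟨ rangeSum-Σˢ f lo (suc hi) ⟩
    Σˢ (λ i → f (lo + i)) (suc (suc hi) ∸ lo)       ≈⟨ ≈-reflexive (cong (Σˢ (λ i → f (lo + i))) (ℕP.+-∸-assoc 1 le)) ⟩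
    Σˢ (λ i → f (lo + i)) (suc (suc hi ∸ lo))       ≈⟨ Σˢ-snoc (λ i → f (lo + i)) (suc hi ∸ lo) ⟩
    Σˢ (λ i → f (lo + i)) (suc hi ∸ lo) +ˢ f (lo + (suc hi ∸ lo))
      ≈⟨ +-cong (≈-sym (rangeSum-Σˢ f lo hi)) (≈-reflexive (cong f (ℕP.m+[n∸m]≡n le))) ⟩
    rangeSum f lo hi +ˢ f (suc hi)                  ∎
  where open ≈-Reasoning

rangeSum-single : ∀ f m → rangeSum f (suc m) (suc m) ≈ f (suc m)
rangeSum-single f m = ≈-trans (rangeSum-snoc f (suc m) m ℕP.≤-refl)
  (≈-trans (+-cong empty (refl≈ (f (suc m)))) (+-identityˡ (f (suc m))))
  where
  empty : rangeSum f (suc m) m ≈ 0ˢ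
  empty = ≈-trans (rangeSum-Σˢ f (suc m) m) (≈-reflexive (cong (Σˢ (λ i → f (suc m + i))) (ℕP.n∸n≡0 m)))

range-bound : ∀ lo hi i → i < suc hi ∸ lo → lo + i ≤ hi
range-bound zero     hi       i lt = ℕP.≤-pred lt
range-bound (suc lo) zero     i lt rewrite ℕP.0∸n≡0 lo with lt
... | ()
range-bound (suc lo) (suc hi) i lt = s≤s (range-bound lo hi i lt)

rangeSum-cong : ∀ f h lo hi → (∀ m → lo ≤ m → m ≤ hi → f m ≈ h m) → rangeSum f lo hi ≈ rangeSum h lo hi
rangeSum-cong f h lo hi e = ≈-trans (rangeSum-Σˢ f lo hi)
  (≈-trans (Σˢ-cong (λ i → f (lo + i)) (λ i → h (lo + i)) (suc hi ∸ lo)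
              (λ i lt → e (lo + i) (ℕP.m≤m+n lo i) (range-bound lo hi i lt)))
           (≈-sym (rangeSum-Σˢ h lo hi)))

rangeSum-+ : ∀ f h lo hi → rangeSum (λ m → f m +ˢ h m) lo hi ≈ (rangeSum f lo hi +ˢ rangeSum h lo hi)
rangeSum-+ f h lo hi = sumˢ-+ f h (range lo hi)

rangeSum-- : ∀ f h lo hi → rangeSum (λ m → f m -ˢ h m) lo hi ≈ (rangeSum f lo hi -ˢ rangeSum h lo hi)
rangeSum-- f h lo hi = ≈-trans (rangeSum-+ f (λ m → negˢ (h m)) lo hi) (+-cong (refl≈ (rangeSum f lo hi)) (sumˢ-neg h (range lo hi)))

rangeSum-scaleˡ : ∀ c f lo hi → rangeSum (λ m → c *ˢ f m) lo hi ≈ (c *ˢ rangeSum f lo hi)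
rangeSum-scaleˡ c f lo hi = sumˢ-scale c f (range lo hi)

rangeSum-scaleʳ : ∀ f c lo hi → rangeSum (λ m → f m *ˢ c) lo hi ≈ (rangeSum f lo hi *ˢ c)
rangeSum-scaleʳ f c lo hi = ≈-trans (rangeSum-cong (λ m → f m *ˢ c) (λ m → c *ˢ f m) lo hi (λ m _ _ → *-comm (f m) c))
  (≈-trans (rangeSum-scaleˡ c f lo hi) (*-comm c (rangeSum f lo hi)))

telescope : ∀ (G : ℕ → Series) M → rangeSum (λ j → G j -ˢ G (suc j)) 1 M ≈ (G 1 -ˢ G (suc M))
telescope G zero    = solve 1 (λ a → Κ (+ 0) ⊜ a ⊖ a) ≈-refl (G 1)
telescope G (suc M) = ≈-trans (rangeSum-snoc (λ j → G j -ˢ G (suc j)) 1 M (s≤s z≤n))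
  (≈-trans (+-cong (telescope G M) (refl≈ (G (suc M) -ˢ G (suc (suc M)))))
    (solve 3 (λ a b c → (a ⊖ b) ⊕ (b ⊖ c) ⊜ a ⊖ c) ≈-refl (G 1) (G (suc M)) (G (suc (suc M)))))

Πˢ : (ℕ → Series) → ℕ → Series
Πˢ f zero    = 1ˢ
Πˢ f (suc n) = f 0 *ˢ Πˢ (f ∘ suc) n

prodˢ-applyUpTo : ∀ (f : ℕ → Series) g n → prodˢ (map f (applyUpTo g n)) ≈ Πˢ (f ∘ g) n
prodˢ-applyUpTo f g zero    = ≈-refl
prodˢ-applyUpTo f g (suc n) = *-cong (refl≈ (f (g 0))) (prodˢ-applyUpTo f (g ∘ suc) n)

Πˢ-snoc : ∀ f n → Πˢ f (suc n) ≈ (Πˢ f n *ˢ f n)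
Πˢ-snoc f zero    = ≈-trans (*-identityʳ (f 0)) (≈-sym (*-identityˡ (f 0)))
Πˢ-snoc f (suc n) = ≈-trans (*-cong (refl≈ (f 0)) (Πˢ-snoc (f ∘ suc) n)) (≈-sym (*-assoc (f 0) (Πˢ (f ∘ suc) n) (f (suc n))))

poch-snoc : ∀ a x n → poch a x (suc n) ≈ (poch a x n *ˢ (1ˢ -ˢ a *ˢ powˢ x n))
poch-snoc a x n = ≈-trans (prodˢ-applyUpTo φ (λ i → i) (suc n))
  (≈-trans (Πˢ-snoc φ n) (*-cong (≈-sym (prodˢ-applyUpTo φ (λ i → i) n)) (refl≈ (φ n))))
  where
  φ : ℕ → Series
  φ j = 1ˢ -ˢ a *ˢ powˢ x j

evenFactor : ℕ → Series
evenFactor m = 1ˢ -ˢ X^ (2 * m)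

oddFactor : ℕ → Series
oddFactor m = 1ˢ +ˢ X^ (suc (2 * m))

pochEven : ℕ → Series
pochEven n = poch q² q² n

pochOdd : ℕ → Series
pochOdd n = poch (negˢ q) q² n

pochEven-snoc : ∀ n → pochEven (suc n) ≈ (pochEven n *ˢ evenFactor (suc n))
pochEven-snoc n = ≈-trans (poch-snoc q² q² n) (*-cong (refl≈ (pochEven n)) (-ˢ-cong (refl≈ 1ˢ) q²ⁿ⁺²))
  where
  q²ⁿ⁺² : (q² *ˢ powˢ q² n) ≈ X^ (2 * suc n)
  q²ⁿ⁺² = ≈-trans (*-cong (refl≈ q²) (pow-X^ 2 n)) (≈-trans (≈-sym (X^-+ 2 (n * 2)))
    (X^-≡ (trans (cong (_+_ 2) (ℕP.*-comm n 2)) (sym (ℕP.*-suc 2 n)))))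

pochOdd-snoc : ∀ n → pochOdd (suc n) ≈ (pochOdd n *ˢ oddFactor n)
pochOdd-snoc n = ≈-trans (poch-snoc (negˢ q) q² n) (*-cong (refl≈ (pochOdd n)) factor)
  where
  q²ⁿ⁺¹ : (q *ˢ powˢ q² n) ≈ X^ (suc (2 * n))
  q²ⁿ⁺¹ = ≈-trans (*-cong (refl≈ q) (pow-X^ 2 n)) (≈-trans (≈-sym (X^-+ 1 (n * 2))) (X^-≡ (cong suc (ℕP.*-comm n 2))))
  factor : (1ˢ -ˢ negˢ q *ˢ powˢ q² n) ≈ oddFactor n
  factor k = cong (1ˢ k +ℤ_) (trans (cong -_ (*ˢ-negˡ q (powˢ q² n) k))
    (trans (ℤP.neg-involutive ((q *ˢ powˢ q² n) k)) (q²ⁿ⁺¹ k)))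

pochEven-ConstOne : ∀ n → ConstOne (pochEven n)
pochEven-ConstOne zero    = refl
pochEven-ConstOne (suc n) = trans (pochEven-snoc n zero) (ConstOne-* (pochEven n) (evenFactor (suc n)) (pochEven-ConstOne n) refl)

pochOdd-ConstOne : ∀ n → ConstOne (pochOdd n)
pochOdd-ConstOne zero    = refl
pochOdd-ConstOne (suc n) = trans (pochOdd-snoc n zero) (ConstOne-* (pochOdd n) (oddFactor n) (pochOdd-ConstOne n) refl)

pochEven-≡ : ∀ {a b} → a ≡ b → pochEven a ≈ pochEven b
pochEven-≡ refl = ≈-refl

invPochEven-≡ : ∀ {a b} → a ≡ b → invˢ (pochEven a) ≈ invˢ (pochEven b)
invPochEven-≡ refl = ≈-refl

invPochEven-snoc : ∀ n → invˢ (pochEven (suc n)) ≈ (invˢ (pochEven n) *ˢ invˢ (evenFactor (suc n)))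
invPochEven-snoc n = ≈-trans (invˢ-cong (pochEven (suc n)) (pochEven n *ˢ evenFactor (suc n)) (pochEven-ConstOne (suc n)) (pochEven-snoc n))
  (invˢ-* (pochEven n) (evenFactor (suc n)) (pochEven-ConstOne n) refl)

pochFrom : ℕ → ℕ → Series
pochFrom a zero    = 1ˢ
pochFrom a (suc n) = pochFrom a n *ˢ evenFactor (suc (a + n))

pochFrom-ConstOne : ∀ a n → ConstOne (pochFrom a n)
pochFrom-ConstOne a zero    = refl
pochFrom-ConstOne a (suc n) = ConstOne-* (pochFrom a n) (evenFactor (suc (a + n))) (pochFrom-ConstOne a n) refl

pochEven-split : ∀ a n → pochEven (a + n) ≈ (pochEven a *ˢ pochFrom a n)
pochEven-split a zero    = ≈-trans (pochEven-≡ (ℕP.+-identityʳ a)) (≈-sym (*-identityʳ (pochEven a)))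
pochEven-split a (suc n) = ≈-trans (pochEven-≡ (ℕP.+-suc a n)) (≈-trans (pochEven-snoc (a + n))
  (≈-trans (*-cong (pochEven-split a n) (refl≈ (evenFactor (suc (a + n))))) (*-assoc (pochEven a) (pochFrom a n) (evenFactor (suc (a + n))))))

pochRatio : ℕ → Series
pochRatio m = pochEven m /ˢ pochOdd m

pochRatio-snoc : ∀ M → pochRatio (suc M) ≈ (pochRatio M *ˢ evenFactor (suc M) *ˢ invˢ (oddFactor M))
pochRatio-snoc M = ≈-trans (*-cong (pochEven-snoc M)
    (≈-trans (invˢ-cong (pochOdd (suc M)) (pochOdd M *ˢ oddFactor M) (pochOdd-ConstOne (suc M)) (pochOdd-snoc M))
             (invˢ-* (pochOdd M) (oddFactor M) (pochOdd-ConstOne M) refl)))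
  (solve 4 (λ a b c d → (a ⊗ b) ⊗ (c ⊗ d) ⊜ a ⊗ c ⊗ b ⊗ d) ≈-refl (pochEven M) (evenFactor (suc M)) (invˢ (pochOdd M)) (invˢ (oddFactor M)))

chainTail : ℕ → ℕ → ℕ → Series
chainTail k m M = sumˢ (map prodG (chains k m M))

chainTail-zero : ∀ m M → chainTail 0 m M ≈ 1ˢ
chainTail-zero m M = +-identityʳ 1ˢ

weightedChains : (ℕ → Series) → ℕ → ℕ → ℕ → Series
weightedChains h k m M = rangeSum (λ n → h n *ˢ chainTail k n M) m M

chainSum-head : ∀ (f : List ℕ → Series) (h : ℕ → Series) → (∀ m t → f (m ∷ t) ≈ (h m *ˢ prodG t)) →
  ∀ k m M → sumˢ (map f (chains (suc k) m M)) ≈ weightedChains h k m M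
chainSum-head f h e k m M = ≈-trans (sumˢ-concatMap f (λ n → map (n ∷_) (chains k n M)) (range m M))
  (sumˢ-cong (λ n → sumˢ (map f (map (n ∷_) (chains k n M)))) (λ n → h n *ˢ chainTail k n M) (range m M)
    (λ n → ≈-trans (sumˢ-map-map f (n ∷_) (chains k n M))
      (≈-trans (sumˢ-cong (λ t → f (n ∷ t)) (λ t → h n *ˢ prodG t) (chains k n M) (e n))
        (sumˢ-scale (h n) prodG (chains k n M)))))

chainTail-head : ∀ k m M → chainTail (suc k) m M ≈ weightedChains g k m M
chainTail-head = chainSum-head prodG g (λ _ _ → ≈-refl)

chainTail-top : ∀ k M → chainTail (suc k) (suc M) (suc M) ≈ (g (suc M) *ˢ chainTail k (suc M) (suc M))
chainTail-top k M = ≈-trans (chainTail-head k (suc M) (suc M)) (rangeSum-single (λ n → g n *ˢ chainTail k n (suc M)) M)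

mutual
  chainTail-last : ∀ k M m → m ≤ suc M →
    chainTail (suc k) m (suc M) ≈ (chainTail (suc k) m M +ˢ g (suc M) *ˢ chainTail k m (suc M))
  chainTail-last zero M m le = ≈-trans (chainTail-head 0 m (suc M))
    (≈-trans (rangeSum-snoc (λ n → g n *ˢ chainTail 0 n (suc M)) m M le)
      (+-cong (≈-sym (chainTail-head 0 m M)) ≈-refl))
  chainTail-last (suc k) M m le = ≈-trans (chainTail-head (suc k) m (suc M))
    (≈-trans (weightedChains-last g k M m le)
      (+-cong (≈-sym (chainTail-head (suc k) m M)) (*-cong (refl≈ (g (suc M))) (≈-sym (chainTail-head k m (suc M))))))

  weightedChains-last : ∀ h k M m → m ≤ suc M →
    weightedChains h (suc k) m (suc M) ≈ (weightedChains h (suc k) m M +ˢ g (suc M) *ˢ weightedChains h k m (suc M))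
  weightedChains-last h k M m le = begin
      weightedChains h (suc k) m (suc M)           ≈⟨ rangeSum-snoc φ m M le ⟩
      rangeSum φ m M +ˢ φ (suc M)                   ≈⟨ +-cong inner top ⟩
      (weightedChains h (suc k) m M +ˢ G *ˢ rangeSum φ′ m M) +ˢ G *ˢ φ′ (suc M)
        ≈⟨ solve 4 (λ a G b c → (a ⊕ G ⊗ b) ⊕ G ⊗ c ⊜ a ⊕ G ⊗ (b ⊕ c)) ≈-refl
             (weightedChains h (suc k) m M) G (rangeSum φ′ m M) (φ′ (suc M)) ⟩
      weightedChains h (suc k) m M +ˢ G *ˢ (rangeSum φ′ m M +ˢ φ′ (suc M))
        ≈⟨ +-cong (refl≈ (weightedChains h (suc k) m M)) (*-cong (refl≈ G) (≈-sym (rangeSum-snoc φ′ m M le))) ⟩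
      weightedChains h (suc k) m M +ˢ G *ˢ weightedChains h k m (suc M) ∎
    where
    open ≈-Reasoning
    G : Series
    G = g (suc M)
    φ φ′ : ℕ → Series
    φ  n = h n *ˢ chainTail (suc k) n (suc M)
    φ′ n = h n *ˢ chainTail k n (suc M)
    inner : rangeSum φ m M ≈ (weightedChains h (suc k) m M +ˢ G *ˢ rangeSum φ′ m M)
    inner = ≈-trans
      (rangeSum-cong φ (λ n → h n *ˢ chainTail (suc k) n M +ˢ G *ˢ φ′ n) m M
        (λ n _ n≤M → ≈-trans (*-cong (refl≈ (h n)) (chainTail-last k M n (ℕP.m≤n⇒m≤1+n n≤M)))
          (solve 4 (λ a b G c → a ⊗ (b ⊕ G ⊗ c) ⊜ a ⊗ b ⊕ G ⊗ (a ⊗ c)) ≈-refl (h n) (chainTail (suc k) n M) G (chainTail k n (suc M)))))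
      (≈-trans (rangeSum-+ (λ n → h n *ˢ chainTail (suc k) n M) (λ n → G *ˢ φ′ n) m M)
        (+-cong (refl≈ (weightedChains h (suc k) m M)) (rangeSum-scaleˡ G φ′ m M)))
    top : φ (suc M) ≈ (G *ˢ φ′ (suc M))
    top = ≈-trans (*-cong (refl≈ (h (suc M))) (chainTail-top k M))
      (solve 3 (λ a G b → a ⊗ (G ⊗ b) ⊜ G ⊗ (a ⊗ b)) ≈-refl (h (suc M)) G (chainTail k (suc M) (suc M)))

-- The excess of the left-hand side over the chain sum of the right-hand side:
-- excess 0 M = pochRatio M - 1 and, for k ≥ 1,
-- excess k M = Σ_{1 ≤ n₁ ≤ ... ≤ n_k ≤ M} (pochRatio n₁ - 1) ∏ᵢ g nᵢ.
excess : ℕ → ℕ → Series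
excess zero    M = pochRatio M -ˢ 1ˢ
excess (suc k) M = weightedChains (λ n → (pochRatio n -ˢ 1ˢ) *ˢ g n) k 1 M

lhs-decomposition : ∀ k N →
  sumˢ (map lhsTerm (chains (suc k) 1 N)) ≈ (sumˢ (map prodG (chains (suc k) 1 N)) +ˢ excess (suc k) N)
lhs-decomposition k N = begin
    sumˢ (map lhsTerm (chains (suc k) 1 N))
      ≈⟨ chainSum-head lhsTerm (λ m → pochRatio m *ˢ g m) (λ m t → ≈-sym (*-assoc (pochRatio m) (g m) (prodG t))) k 1 N ⟩
    weightedChains (λ m → pochRatio m *ˢ g m) k 1 N
      ≈⟨ rangeSum-cong _ (λ m → g m *ˢ chainTail k m N +ˢ ((pochRatio m -ˢ 1ˢ) *ˢ g m) *ˢ chainTail k m N) 1 N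
           (λ m _ _ → solve 3 (λ c a w → (c ⊗ a) ⊗ w ⊜ a ⊗ w ⊕ ((c ⊖ one) ⊗ a) ⊗ w) ≈-refl (pochRatio m) (g m) (chainTail k m N)) ⟩
    rangeSum (λ m → g m *ˢ chainTail k m N +ˢ ((pochRatio m -ˢ 1ˢ) *ˢ g m) *ˢ chainTail k m N) 1 N
      ≈⟨ rangeSum-+ (λ m → g m *ˢ chainTail k m N) (λ m → ((pochRatio m -ˢ 1ˢ) *ˢ g m) *ˢ chainTail k m N) 1 N ⟩
    weightedChains g k 1 N +ˢ excess (suc k) N
      ≈⟨ +-cong (≈-sym (chainTail-head k 1 N)) (refl≈ (excess (suc k) N)) ⟩
    sumˢ (map prodG (chains (suc k) 1 N)) +ˢ excess (suc k) N ∎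
  where open ≈-Reasoning

excess-last : ∀ k M → excess (suc k) (suc M) ≈ (excess (suc k) M +ˢ g (suc M) *ˢ excess k (suc M))
excess-last zero    M = ≈-trans (rangeSum-snoc (λ n → h n *ˢ chainTail 0 n (suc M)) 1 M (s≤s z≤n))
  (+-cong (refl≈ (excess 1 M))
    (≈-trans (*-cong (refl≈ (h (suc M))) (chainTail-zero (suc M) (suc M)))
      (≈-trans (*-identityʳ (h (suc M))) (*-comm (pochRatio (suc M) -ˢ 1ˢ) (g (suc M))))))
  where
  h : ℕ → Series
  h n = (pochRatio n -ˢ 1ˢ) *ˢ g n
excess-last (suc k) M = weightedChains-last (λ n → (pochRatio n -ˢ 1ˢ) *ˢ g n) k M 1 (s≤s z≤n)

-- The weights of the finite expansion of pochRatio: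
--   limitWeight j = (-1)ʲ q^{j(2j-1)} (1 + q^{2j}),
--   weight j M    = limitWeight j · (q²;q²)_M² / ((q²;q²)_{M-j} (q²;q²)_{M+j}),
-- so that weight j M → limitWeight j as M → ∞.
sign : ℕ → Series
sign j = powˢ (negˢ 1ˢ) j

limitWeight : ℕ → Series
limitWeight j = sign j *ˢ X^ (j * (2 * j ∸ 1)) *ˢ (1ˢ +ˢ X^ (2 * j))

weight : ℕ → ℕ → Series
weight j M = limitWeight j *ˢ (pochEven M *ˢ pochEven M) *ˢ invˢ (pochEven (M ∸ j)) *ˢ invˢ (pochEven (M + j))

suc[j+t]∸j : ∀ j t → suc (j + t) ∸ j ≡ suc t
suc[j+t]∸j j t = trans (cong (_∸ j) (sym (ℕP.+-suc j t))) (ℕP.m+n∸m≡n j (suc t))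

weight-snoc : ∀ j t → weight j (suc (j + t)) ≈
  (weight j (j + t) *ˢ (powˢ (evenFactor (suc (j + t))) 2 *ˢ invˢ (evenFactor (suc t)) *ˢ invˢ (evenFactor (suc (j + t + j)))))
weight-snoc j t = begin
    weight j (suc M)
      ≈⟨ *-cong (*-cong (*-cong (refl≈ (limitWeight j)) (*-cong (pochEven-snoc M) (pochEven-snoc M)))
                        (≈-trans (invPochEven-≡ (suc[j+t]∸j j t)) (invPochEven-snoc t)))
                (invPochEven-snoc (M + j)) ⟩
    limitWeight j *ˢ ((BM *ˢ uL) *ˢ (BM *ˢ uL)) *ˢ (iBt *ˢ v1) *ˢ (iBMj *ˢ v2)
      ≈⟨ solve 7 (λ a BM uL iBt v1 iBMj v2 →
           a ⊗ ((BM ⊗ uL) ⊗ (BM ⊗ uL)) ⊗ (iBt ⊗ v1) ⊗ (iBMj ⊗ v2) ⊜ a ⊗ (BM ⊗ BM) ⊗ iBt ⊗ iBMj ⊗ (uL ⊗ (uL ⊗ one) ⊗ v1 ⊗ v2))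
           ≈-refl (limitWeight j) BM uL iBt v1 iBMj v2 ⟩
    limitWeight j *ˢ (BM *ˢ BM) *ˢ iBt *ˢ iBMj *ˢ (powˢ uL 2 *ˢ v1 *ˢ v2)
      ≈⟨ *-cong (*-cong (*-cong (refl≈ (limitWeight j *ˢ (BM *ˢ BM))) (invPochEven-≡ (sym (ℕP.m+n∸m≡n j t)))) (refl≈ iBMj))
                (refl≈ (powˢ uL 2 *ˢ v1 *ˢ v2)) ⟩
    weight j M *ˢ (powˢ uL 2 *ˢ v1 *ˢ v2) ∎
  where
  open ≈-Reasoning
  M : ℕ
  BM uL iBt v1 iBMj v2 : Series
  M = j + t
  BM = pochEven M
  uL = evenFactor (suc M)
  iBt = invˢ (pochEven t)
  v1 = invˢ (evenFactor (suc t))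
  iBMj = invˢ (pochEven (M + j))
  v2 = invˢ (evenFactor (suc (M + j)))

-- The rational-function identity behind weight-g-relation, with A = q^{2j},
-- E = q^{2(M-j+1)} and v₁, v₂, w_j, w_L standing for the inverses of
-- 1-E, 1-A²E, (1-A)², (1-AE)²:
--   (1-AE)² v₁ v₂ (A w_j - AE w_L) = A w_j.
weight-g-core : ∀ A E v1 v2 wj wL →
  ((1ˢ -ˢ E) *ˢ v1) ≈ 1ˢ → ((1ˢ -ˢ A *ˢ (A *ˢ E)) *ˢ v2) ≈ 1ˢ →
  (powˢ (1ˢ -ˢ A) 2 *ˢ wj) ≈ 1ˢ → (powˢ (1ˢ -ˢ A *ˢ E) 2 *ˢ wL) ≈ 1ˢ →
  ConstOne (((1ˢ -ˢ E) *ˢ (1ˢ -ˢ A *ˢ (A *ˢ E))) *ˢ powˢ (1ˢ -ˢ A) 2) →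
  (((powˢ (1ˢ -ˢ A *ˢ E) 2 *ˢ v1) *ˢ v2) *ˢ (A *ˢ wj -ˢ (A *ˢ E) *ˢ wL)) ≈ (A *ˢ wj)
weight-g-core A E v1 v2 wj wL h1 h2 h3 h4 up =
  cancel-ConstOne (((uL2 *ˢ v1) *ˢ v2) *ˢ (A *ˢ wj -ˢ (A *ˢ E) *ˢ wL)) (A *ˢ wj) p up (begin
    (((uL2 *ˢ v1) *ˢ v2) *ˢ (A *ˢ wj -ˢ (A *ˢ E) *ˢ wL)) *ˢ p
      ≈⟨ solve 10 (λ uL2 v1 v2 A wj E wL u1 u2 dj →
           (((uL2 ⊗ v1) ⊗ v2) ⊗ (A ⊗ wj ⊖ (A ⊗ E) ⊗ wL)) ⊗ ((u1 ⊗ u2) ⊗ dj)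
           ⊜ ((u1 ⊗ v1) ⊗ (u2 ⊗ v2)) ⊗ (uL2 ⊗ A ⊗ (dj ⊗ wj) ⊖ (A ⊗ E) ⊗ dj ⊗ (uL2 ⊗ wL)))
           ≈-refl uL2 v1 v2 A wj E wL u1 u2 dj ⟩
    ((u1 *ˢ v1) *ˢ (u2 *ˢ v2)) *ˢ (uL2 *ˢ A *ˢ (dj *ˢ wj) -ˢ (A *ˢ E) *ˢ dj *ˢ (uL2 *ˢ wL))
      ≈⟨ *-cong (*-cong h1 h2) (-ˢ-cong (*-cong (refl≈ (uL2 *ˢ A)) h3) (*-cong (refl≈ ((A *ˢ E) *ˢ dj)) h4)) ⟩
    (1ˢ *ˢ 1ˢ) *ˢ (uL2 *ˢ A *ˢ 1ˢ -ˢ (A *ˢ E) *ˢ dj *ˢ 1ˢ)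
      ≈⟨ solve 2 (λ A E → (one ⊗ one) ⊗ (((one ⊖ A ⊗ E) ⊗ ((one ⊖ A ⊗ E) ⊗ one)) ⊗ A ⊗ one ⊖ (A ⊗ E) ⊗ ((one ⊖ A) ⊗ ((one ⊖ A) ⊗ one)) ⊗ one)
            ⊜ (A ⊗ ((one ⊖ E) ⊗ (one ⊖ A ⊗ (A ⊗ E)))) ⊗ one) ≈-refl A E ⟩
    (A *ˢ (u1 *ˢ u2)) *ˢ 1ˢ
      ≈⟨ *-cong (refl≈ (A *ˢ (u1 *ˢ u2))) (≈-sym h3) ⟩
    (A *ˢ (u1 *ˢ u2)) *ˢ (dj *ˢ wj)
      ≈⟨ solve 5 (λ A u1 u2 dj wj → (A ⊗ (u1 ⊗ u2)) ⊗ (dj ⊗ wj) ⊜ (A ⊗ wj) ⊗ ((u1 ⊗ u2) ⊗ dj)) ≈-refl A u1 u2 dj wj ⟩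
    (A *ˢ wj) *ˢ p ∎)
  where
  open ≈-Reasoning
  u1 u2 uL2 dj p : Series
  u1 = 1ˢ -ˢ E
  u2 = 1ˢ -ˢ A *ˢ (A *ˢ E)
  uL2 = powˢ (1ˢ -ˢ A *ˢ E) 2
  dj = powˢ (1ˢ -ˢ A) 2
  p = (u1 *ˢ u2) *ˢ dj

-- weight j (M+1) · (g j - g (M+1)) = weight j M · g j   for 1 ≤ j ≤ M, with
-- j = i+1 and M = j+t; this is what makes excess (k+1) a combination of g j^{k+1}.
weight-g-relation-at : ∀ i t → (weight (suc i) (suc (suc i + t)) *ˢ (g (suc i) -ˢ g (suc (suc i + t)))) ≈ (weight (suc i) (suc i + t) *ˢ g (suc i))
weight-g-relation-at i t = begin
    weight j (suc M) *ˢ (g j -ˢ g (suc M))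
      ≈⟨ *-cong (weight-snoc j t) (-ˢ-cong (refl≈ (g j)) gL) ⟩
    (weight j M *ˢ (powˢ uL 2 *ˢ v1 *ˢ v2)) *ˢ (A *ˢ wj -ˢ (A *ˢ E) *ˢ wL)
      ≈⟨ *-assoc (weight j M) (powˢ uL 2 *ˢ v1 *ˢ v2) (A *ˢ wj -ˢ (A *ˢ E) *ˢ wL) ⟩
    weight j M *ˢ ((powˢ uL 2 *ˢ v1 *ˢ v2) *ˢ (A *ˢ wj -ˢ (A *ˢ E) *ˢ wL))
      ≈⟨ *-cong (refl≈ (weight j M))
           (≈-trans (*-cong (*-cong (*-cong (pow-cong 2 uLe) (refl≈ v1)) (refl≈ v2)) (refl≈ (A *ˢ wj -ˢ (A *ˢ E) *ˢ wL)))
                    (weight-g-core A E v1 v2 wj wL (invˢ-inverseʳ (evenFactor (suc t)) refl) h2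
                       (invˢ-inverseʳ (powˢ (evenFactor j) 2) (ConstOne-pow (evenFactor j) 2 refl)) h4 up)) ⟩
    weight j M *ˢ g j ∎
  where
  open ≈-Reasoning
  j M : ℕ
  A E uL v1 v2 wj wL : Series
  j = suc i
  M = suc i + t
  A = X^ (2 * j)
  E = X^ (2 * suc t)
  uL = evenFactor (suc M)
  v1 = invˢ (evenFactor (suc t))
  v2 = invˢ (evenFactor (suc (M + j)))
  wj = invˢ (powˢ (evenFactor j) 2)
  wL = invˢ (powˢ (evenFactor (suc M)) 2)
  e₁ : ∀ i t → 2 * suc (suc i + t) ≡ 2 * suc i + 2 * suc t
  e₁ = ℕSolver.solve-∀
  e₂ : ∀ i t → 2 * suc (suc i + t + suc i) ≡ 2 * suc i + (2 * suc i + 2 * suc t)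
  e₂ = ℕSolver.solve-∀
  XL : X^ (2 * suc M) ≈ (A *ˢ E)
  XL = ≈-trans (X^-≡ (e₁ i t)) (X^-+ (2 * j) (2 * suc t))
  XLj : X^ (2 * suc (M + j)) ≈ (A *ˢ (A *ˢ E))
  XLj = ≈-trans (X^-≡ (e₂ i t)) (≈-trans (X^-+ (2 * j) (2 * j + 2 * suc t)) (*-cong (refl≈ A) (X^-+ (2 * j) (2 * suc t))))
  uLe : uL ≈ (1ˢ -ˢ A *ˢ E)
  uLe = -ˢ-cong (refl≈ 1ˢ) XL
  gL : g (suc M) ≈ ((A *ˢ E) *ˢ wL)
  gL = *-cong XL (refl≈ wL)
  h2 : ((1ˢ -ˢ A *ˢ (A *ˢ E)) *ˢ v2) ≈ 1ˢ
  h2 = ≈-trans (*-cong (≈-sym (-ˢ-cong (refl≈ 1ˢ) XLj)) (refl≈ v2)) (invˢ-inverseʳ (evenFactor (suc (M + j))) refl)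
  h4 : (powˢ (1ˢ -ˢ A *ˢ E) 2 *ˢ wL) ≈ 1ˢ
  h4 = ≈-trans (*-cong (≈-sym (pow-cong 2 uLe)) (refl≈ wL)) (invˢ-inverseʳ (powˢ (evenFactor (suc M)) 2) (ConstOne-pow (evenFactor (suc M)) 2 refl))
  up : ConstOne (((1ˢ -ˢ E) *ˢ (1ˢ -ˢ A *ˢ (A *ˢ E))) *ˢ powˢ (1ˢ -ˢ A) 2)
  up = ConstOne-* ((1ˢ -ˢ E) *ˢ (1ˢ -ˢ A *ˢ (A *ˢ E))) (powˢ (1ˢ -ˢ A) 2)
         (ConstOne-* (1ˢ -ˢ E) (1ˢ -ˢ A *ˢ (A *ˢ E)) refl (ConstOne-1- (A *ˢ (A *ˢ E)) (NoConst-* A (A *ˢ E) refl)))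
         (ConstOne-pow (1ˢ -ˢ A) 2 refl)

weight-g-relation : ∀ M j → 1 ≤ j → j ≤ M → (weight j (suc M) *ˢ (g j -ˢ g (suc M))) ≈ (weight j M *ˢ g j)
weight-g-relation M (suc i) _ le =
  subst (λ M → (weight (suc i) (suc M) *ˢ (g (suc i) -ˢ g (suc M))) ≈ (weight (suc i) M *ˢ g (suc i)))
        (ℕP.m+[n∸m]≡n le) (weight-g-relation-at i (M ∸ suc i))

telescopeTerm : ℕ → ℕ → Series
telescopeTerm j L = sign j *ˢ X^ (j * (2 * j ∸ 1)) *ˢ X^ (2 * (L ∸ j)) *ˢ (1ˢ +ˢ X^ (2 * j ∸ 1))
  *ˢ (pochEven L *ˢ pochEven (L ∸ 1)) *ˢ invˢ (pochEven (L ∸ j)) *ˢ invˢ (pochEven (L + j ∸ 1))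

-- The polynomial identity behind one telescoping step, in the atoms
-- q, D = q^{2j-1} and E = q^{2(M-j+1)} (so qDE = q^{2(M+1)}).
telescope-polynomial : ∀ q D E →
  ((1ˢ +ˢ q *ˢ D) *ˢ ((1ˢ -ˢ q *ˢ D *ˢ E) *ˢ (1ˢ +ˢ D *ˢ E) -ˢ (1ˢ -ˢ E) *ˢ (1ˢ -ˢ q *ˢ D *ˢ (q *ˢ D *ˢ E))))
  ≈ (E *ˢ (1ˢ +ˢ D) *ˢ (1ˢ -ˢ q *ˢ D *ˢ (q *ˢ D *ˢ E)) +ˢ (q *ˢ D *ˢ D *ˢ E) *ˢ (1ˢ +ˢ q *ˢ q *ˢ D) *ˢ (1ˢ -ˢ E))
telescope-polynomial = solve 3 (λ q D E →
   (one ⊕ q ⊗ D) ⊗ ((one ⊖ q ⊗ D ⊗ E) ⊗ (one ⊕ D ⊗ E) ⊖ (one ⊖ E) ⊗ (one ⊖ q ⊗ D ⊗ (q ⊗ D ⊗ E)))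
   ⊜ E ⊗ (one ⊕ D) ⊗ (one ⊖ q ⊗ D ⊗ (q ⊗ D ⊗ E)) ⊕ (q ⊗ D ⊗ D ⊗ E) ⊗ (one ⊕ q ⊗ q ⊗ D) ⊗ (one ⊖ E)) ≈-refl

-- One telescoping step as a ring identity: Ω is the common factor of
-- weight j M = Ω (1 + qD), and v₁, v₂ invert 1 - E and 1 - q²D²E.
telescope-core : ∀ Ω q D E v1 v2 → ((1ˢ -ˢ E) *ˢ v1) ≈ 1ˢ → ((1ˢ -ˢ q *ˢ D *ˢ (q *ˢ D *ˢ E)) *ˢ v2) ≈ 1ˢ →
  ConstOne ((1ˢ -ˢ E) *ˢ (1ˢ -ˢ q *ˢ D *ˢ (q *ˢ D *ˢ E))) →
  ((Ω *ˢ (1ˢ +ˢ q *ˢ D) *ˢ (powˢ (1ˢ -ˢ q *ˢ D *ˢ E) 2 *ˢ v1 *ˢ v2)) *ˢ (1ˢ +ˢ D *ˢ E) -ˢ (Ω *ˢ (1ˢ +ˢ q *ˢ D)) *ˢ (1ˢ -ˢ q *ˢ D *ˢ E))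
  ≈ (Ω *ˢ E *ˢ (1ˢ +ˢ D) *ˢ ((1ˢ -ˢ q *ˢ D *ˢ E) *ˢ v1) -ˢ negˢ Ω *ˢ (q *ˢ D *ˢ D *ˢ E) *ˢ (1ˢ +ˢ q *ˢ q *ˢ D) *ˢ ((1ˢ -ˢ q *ˢ D *ˢ E) *ˢ v2))
telescope-core Ω q D E v1 v2 h1 h2 up = cancel-ConstOne LHS RHS p up (begin
    LHS *ˢ p
      ≈⟨ solve 9 (λ Ω uL q D h v1 v2 u1 u2 →
          ((Ω ⊗ (one ⊕ q ⊗ D) ⊗ ((uL ⊗ (uL ⊗ one)) ⊗ v1 ⊗ v2)) ⊗ h ⊖ (Ω ⊗ (one ⊕ q ⊗ D)) ⊗ uL) ⊗ (u1 ⊗ u2)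
          ⊜ (Ω ⊗ uL) ⊗ ((one ⊕ q ⊗ D) ⊗ (uL ⊗ h ⊗ ((u1 ⊗ v1) ⊗ (u2 ⊗ v2)) ⊖ u1 ⊗ u2))) ≈-refl Ω uL q D h v1 v2 u1 u2 ⟩
    (Ω *ˢ uL) *ˢ ((1ˢ +ˢ q *ˢ D) *ˢ (uL *ˢ h *ˢ ((u1 *ˢ v1) *ˢ (u2 *ˢ v2)) -ˢ u1 *ˢ u2))
      ≈⟨ *-cong (refl≈ (Ω *ˢ uL)) (*-cong (refl≈ (1ˢ +ˢ q *ˢ D)) (-ˢ-cong (*-cong (refl≈ (uL *ˢ h)) (≈-trans (*-cong h1 h2) (*-identityˡ 1ˢ))) (refl≈ (u1 *ˢ u2)))) ⟩
    (Ω *ˢ uL) *ˢ ((1ˢ +ˢ q *ˢ D) *ˢ (uL *ˢ h *ˢ 1ˢ -ˢ u1 *ˢ u2))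
      ≈⟨ *-cong (refl≈ (Ω *ˢ uL)) (*-cong (refl≈ (1ˢ +ˢ q *ˢ D)) (-ˢ-cong (*-identityʳ (uL *ˢ h)) (refl≈ (u1 *ˢ u2)))) ⟩
    (Ω *ˢ uL) *ˢ ((1ˢ +ˢ q *ˢ D) *ˢ (uL *ˢ h -ˢ u1 *ˢ u2))
      ≈⟨ *-cong (refl≈ (Ω *ˢ uL)) (telescope-polynomial q D E) ⟩
    (Ω *ˢ uL) *ˢ (E *ˢ (1ˢ +ˢ D) *ˢ u2 +ˢ (q *ˢ D *ˢ D *ˢ E) *ˢ (1ˢ +ˢ q *ˢ q *ˢ D) *ˢ u1)
      ≈⟨ *-cong (refl≈ (Ω *ˢ uL)) (+-cong (≈-sym (*-identityʳ (E *ˢ (1ˢ +ˢ D) *ˢ u2))) (≈-sym (*-identityʳ ((q *ˢ D *ˢ D *ˢ E) *ˢ (1ˢ +ˢ q *ˢ q *ˢ D) *ˢ u1)))) ⟩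
    (Ω *ˢ uL) *ˢ (E *ˢ (1ˢ +ˢ D) *ˢ u2 *ˢ 1ˢ +ˢ (q *ˢ D *ˢ D *ˢ E) *ˢ (1ˢ +ˢ q *ˢ q *ˢ D) *ˢ u1 *ˢ 1ˢ)
      ≈⟨ *-cong (refl≈ (Ω *ˢ uL)) (+-cong (*-cong (refl≈ (E *ˢ (1ˢ +ˢ D) *ˢ u2)) (≈-sym h1)) (*-cong (refl≈ ((q *ˢ D *ˢ D *ˢ E) *ˢ (1ˢ +ˢ q *ˢ q *ˢ D) *ˢ u1)) (≈-sym h2))) ⟩
    (Ω *ˢ uL) *ˢ (E *ˢ (1ˢ +ˢ D) *ˢ u2 *ˢ (u1 *ˢ v1) +ˢ (q *ˢ D *ˢ D *ˢ E) *ˢ (1ˢ +ˢ q *ˢ q *ˢ D) *ˢ u1 *ˢ (u2 *ˢ v2))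
      ≈⟨ solve 9 (λ Ω uL q D E v1 v2 u1 u2 →
          (Ω ⊗ uL) ⊗ (E ⊗ (one ⊕ D) ⊗ u2 ⊗ (u1 ⊗ v1) ⊕ (q ⊗ D ⊗ D ⊗ E) ⊗ (one ⊕ q ⊗ q ⊗ D) ⊗ u1 ⊗ (u2 ⊗ v2))
          ⊜ (Ω ⊗ E ⊗ (one ⊕ D) ⊗ (uL ⊗ v1) ⊖ (⊝ Ω) ⊗ (q ⊗ D ⊗ D ⊗ E) ⊗ (one ⊕ q ⊗ q ⊗ D) ⊗ (uL ⊗ v2)) ⊗ (u1 ⊗ u2))
          ≈-refl Ω uL q D E v1 v2 u1 u2 ⟩
    RHS *ˢ p ∎)
  where
  open ≈-Reasoning
  uL h u1 u2 p LHS RHS : Series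
  uL = 1ˢ -ˢ q *ˢ D *ˢ E
  h = 1ˢ +ˢ D *ˢ E
  u1 = 1ˢ -ˢ E
  u2 = 1ˢ -ˢ q *ˢ D *ˢ (q *ˢ D *ˢ E)
  p = u1 *ˢ u2
  LHS = (Ω *ˢ (1ˢ +ˢ q *ˢ D) *ˢ (powˢ uL 2 *ˢ v1 *ˢ v2)) *ˢ h -ˢ (Ω *ˢ (1ˢ +ˢ q *ˢ D)) *ˢ uL
  RHS = Ω *ˢ E *ˢ (1ˢ +ˢ D) *ˢ (uL *ˢ v1) -ˢ negˢ Ω *ˢ (q *ˢ D *ˢ D *ˢ E) *ˢ (1ˢ +ˢ q *ˢ q *ˢ D) *ˢ (uL *ˢ v2)

module TelescopeStep (i t : ℕ) where
  -- exponent arithmetic; d = 2j-1 computes to i + suc (i + 0)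
  e₁ : ∀ i → 2 * suc i ≡ 1 + (i + suc (i + 0))
  e₁ = ℕSolver.solve-∀
  e₂ : ∀ i t → 2 * suc (suc i + t) ≡ 1 + (i + suc (i + 0)) + 2 * suc t
  e₂ = ℕSolver.solve-∀
  e₃ : ∀ i t → 2 * suc (suc i + t + suc i) ≡ 1 + (i + suc (i + 0)) + (1 + (i + suc (i + 0)) + 2 * suc t)
  e₃ = ℕSolver.solve-∀
  e₄ : ∀ i t → suc (2 * (suc i + t)) ≡ (i + suc (i + 0)) + 2 * suc t
  e₄ = ℕSolver.solve-∀
  e₅ : ∀ i t → suc (suc i) * (suc i + suc (suc i + 0)) + 2 * t
               ≡ suc i * (i + suc (i + 0)) + (1 + (i + suc (i + 0)) + (i + suc (i + 0)) + 2 * suc t)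
  e₅ = ℕSolver.solve-∀
  e₆ : ∀ i → suc i + suc (suc i + 0) ≡ 1 + 1 + (i + suc (i + 0))
  e₆ = ℕSolver.solve-∀

  -- atoms: D = q^{2j-1} and E = q^{2(t+1)}, so q D = q^{2j} and q D E = q^{2L};
  -- Ω is the common factor in weight j M = Ω (1 + q D).
  j M L d : ℕ
  D E Y s BM iBt iBMj v1 v2 uL′ Ω : Series
  j = suc i
  M = suc i + t
  L = suc M
  d = 2 * j ∸ 1
  D = X^ d
  E = X^ (2 * suc t)
  Y = X^ (j * (2 * j ∸ 1))
  s = sign j
  BM = pochEven M
  iBt = invˢ (pochEven t)
  iBMj = invˢ (pochEven (M + j))
  v1 = invˢ (evenFactor (suc t))
  v2 = invˢ (evenFactor (suc (M + j)))
  uL′ = 1ˢ -ˢ q *ˢ D *ˢ E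
  Ω = s *ˢ Y *ˢ (BM *ˢ BM) *ˢ iBt *ˢ iBMj

  X2j : X^ (2 * j) ≈ (q *ˢ D)
  X2j = ≈-trans (X^-≡ (e₁ i)) (X^-+ 1 d)
  XqDE : ∀ {n} → n ≡ 1 + d + 2 * suc t → X^ n ≈ (q *ˢ D *ˢ E)
  XqDE e = ≈-trans (X^-≡ e) (≈-trans (X^-+ (1 + d) (2 * suc t)) (*-cong (X^-+ 1 d) (refl≈ E)))
  uLe : evenFactor L ≈ uL′
  uLe = -ˢ-cong (refl≈ 1ˢ) (XqDE (e₂ i t))
  u2e : evenFactor (suc (M + j)) ≈ (1ˢ -ˢ q *ˢ D *ˢ (q *ˢ D *ˢ E))
  u2e = -ˢ-cong (refl≈ 1ˢ) (≈-trans (X^-≡ (e₃ i t)) (≈-trans (X^-+ (1 + d) (1 + d + 2 * suc t)) (*-cong (X^-+ 1 d) (XqDE refl))))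
  he : oddFactor M ≈ (1ˢ +ˢ D *ˢ E)
  he = +-cong (refl≈ 1ˢ) (≈-trans (X^-≡ (e₄ i t)) (X^-+ d (2 * suc t)))
  iBLj : invˢ (pochEven (L ∸ j)) ≈ (iBt *ˢ v1)
  iBLj = ≈-trans (invPochEven-≡ (suc[j+t]∸j (suc i) t)) (invPochEven-snoc t)
  iBLj′ : invˢ (pochEven (L + j)) ≈ (iBMj *ˢ v2)
  iBLj′ = invPochEven-snoc (M + j)
  BL : pochEven L ≈ (BM *ˢ uL′)
  BL = ≈-trans (pochEven-snoc M) (*-cong (refl≈ BM) uLe)

  rM : weight j M ≈ (Ω *ˢ (1ˢ +ˢ q *ˢ D))
  rM = ≈-trans (*-cong (*-cong (*-cong (*-cong (refl≈ (s *ˢ Y)) (+-cong (refl≈ 1ˢ) X2j)) (refl≈ (BM *ˢ BM))) (invPochEven-≡ (ℕP.m+n∸m≡n j t))) (refl≈ iBMj))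
    (solve 7 (λ s Y q D BM iBt iBMj → s ⊗ Y ⊗ (one ⊕ q ⊗ D) ⊗ (BM ⊗ BM) ⊗ iBt ⊗ iBMj ⊜ s ⊗ Y ⊗ (BM ⊗ BM) ⊗ iBt ⊗ iBMj ⊗ (one ⊕ q ⊗ D))
       ≈-refl s Y q D BM iBt iBMj)

  rL : weight j L ≈ (Ω *ˢ (1ˢ +ˢ q *ˢ D) *ˢ (powˢ uL′ 2 *ˢ v1 *ˢ v2))
  rL = ≈-trans (weight-snoc j t) (*-cong rM (*-cong (*-cong (pow-cong 2 uLe) (refl≈ v1)) (refl≈ v2)))

  Gj : telescopeTerm j L ≈ (Ω *ˢ E *ˢ (1ˢ +ˢ D) *ˢ (uL′ *ˢ v1))
  Gj = ≈-trans (*-cong (*-cong (*-cong (*-cong (*-cong (refl≈ (s *ˢ Y)) (X^-≡ (cong (_*_ 2) (suc[j+t]∸j (suc i) t)))) (refl≈ (1ˢ +ˢ D))) (*-cong BL (refl≈ BM))) iBLj) (refl≈ iBMj))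
    (solve 9 (λ s Y E D BM uL iBt v1 iBMj → s ⊗ Y ⊗ E ⊗ (one ⊕ D) ⊗ ((BM ⊗ uL) ⊗ BM) ⊗ (iBt ⊗ v1) ⊗ iBMj ⊜ s ⊗ Y ⊗ (BM ⊗ BM) ⊗ iBt ⊗ iBMj ⊗ E ⊗ (one ⊕ D) ⊗ (uL ⊗ v1))
       ≈-refl s Y E D BM uL′ iBt v1 iBMj)

  YX : (X^ (suc j * (2 * suc j ∸ 1)) *ˢ X^ (2 * (L ∸ suc j))) ≈ (Y *ˢ (q *ˢ D *ˢ D *ˢ E))
  YX = ≈-trans (*-cong (refl≈ (X^ (suc j * (2 * suc j ∸ 1)))) (X^-≡ (cong (_*_ 2) (ℕP.m+n∸m≡n i t))))
       (≈-trans (≈-sym (X^-+ (suc j * (2 * suc j ∸ 1)) (2 * t)))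
       (≈-trans (X^-≡ (e₅ i t))
       (≈-trans (X^-+ (j * (2 * j ∸ 1)) (1 + d + d + 2 * suc t))
         (*-cong (refl≈ Y) (≈-trans (X^-+ (1 + d + d) (2 * suc t)) (*-cong (≈-trans (X^-+ (1 + d) d) (*-cong (X^-+ 1 d) (refl≈ D))) (refl≈ E)))))))

  Gj1 : telescopeTerm (suc j) L ≈ (negˢ Ω *ˢ (q *ˢ D *ˢ D *ˢ E) *ˢ (1ˢ +ˢ q *ˢ q *ˢ D) *ˢ (uL′ *ˢ v2))
  Gj1 = begin
      telescopeTerm (suc j) L ≈⟨ *-cong (*-cong (*-cong (*-cong (refl≈ (negˢ 1ˢ *ˢ s *ˢ X^ (suc j * (2 * suc j ∸ 1)) *ˢ X^ (2 * (L ∸ suc j))))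
                           (+-cong (refl≈ 1ˢ) (≈-trans (X^-≡ (e₆ i)) (≈-trans (X^-+ 1 (1 + d)) (*-cong (refl≈ q) (X^-+ 1 d)))))) (*-cong BL (refl≈ BM)))
                        (invPochEven-≡ (ℕP.m+n∸m≡n i t))) (≈-trans (invPochEven-≡ (ℕP.+-suc M j)) iBLj′) ⟩
      negˢ 1ˢ *ˢ s *ˢ X^ (suc j * (2 * suc j ∸ 1)) *ˢ X^ (2 * (L ∸ suc j)) *ˢ (1ˢ +ˢ q *ˢ (q *ˢ D)) *ˢ ((BM *ˢ uL′) *ˢ BM) *ˢ iBt *ˢ (iBMj *ˢ v2)
        ≈⟨ solve 10 (λ s Y1 X2 q D uL BM iBt iBMj v2 →
             ⊝ one ⊗ s ⊗ Y1 ⊗ X2 ⊗ (one ⊕ q ⊗ (q ⊗ D)) ⊗ ((BM ⊗ uL) ⊗ BM) ⊗ iBt ⊗ (iBMj ⊗ v2)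
             ⊜ ⊝ (s ⊗ (Y1 ⊗ X2) ⊗ (BM ⊗ BM) ⊗ iBt ⊗ iBMj) ⊗ (one ⊕ q ⊗ q ⊗ D) ⊗ (uL ⊗ v2))
           ≈-refl s (X^ (suc j * (2 * suc j ∸ 1))) (X^ (2 * (L ∸ suc j))) q D uL′ BM iBt iBMj v2 ⟩
      negˢ (s *ˢ (X^ (suc j * (2 * suc j ∸ 1)) *ˢ X^ (2 * (L ∸ suc j))) *ˢ (BM *ˢ BM) *ˢ iBt *ˢ iBMj) *ˢ (1ˢ +ˢ q *ˢ q *ˢ D) *ˢ (uL′ *ˢ v2)
        ≈⟨ *-cong (*-cong (-‿cong (*-cong (*-cong (*-cong (*-cong (refl≈ s) YX) (refl≈ (BM *ˢ BM))) (refl≈ iBt)) (refl≈ iBMj))) (refl≈ (1ˢ +ˢ q *ˢ q *ˢ D))) (refl≈ (uL′ *ˢ v2)) ⟩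
      negˢ (s *ˢ (Y *ˢ (q *ˢ D *ˢ D *ˢ E)) *ˢ (BM *ˢ BM) *ˢ iBt *ˢ iBMj) *ˢ (1ˢ +ˢ q *ˢ q *ˢ D) *ˢ (uL′ *ˢ v2)
        ≈⟨ solve 10 (λ s Y q D E BM iBt iBMj Pq uL →
             ⊝ (s ⊗ (Y ⊗ (q ⊗ D ⊗ D ⊗ E)) ⊗ (BM ⊗ BM) ⊗ iBt ⊗ iBMj) ⊗ Pq ⊗ uL
             ⊜ ⊝ (s ⊗ Y ⊗ (BM ⊗ BM) ⊗ iBt ⊗ iBMj) ⊗ (q ⊗ D ⊗ D ⊗ E) ⊗ Pq ⊗ uL)
           ≈-refl s Y q D E BM iBt iBMj (1ˢ +ˢ q *ˢ q *ˢ D) (uL′ *ˢ v2) ⟩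
      negˢ Ω *ˢ (q *ˢ D *ˢ D *ˢ E) *ˢ (1ˢ +ˢ q *ˢ q *ˢ D) *ˢ (uL′ *ˢ v2) ∎
    where open ≈-Reasoning

  step : (weight j L *ˢ oddFactor M -ˢ weight j M *ˢ evenFactor L) ≈ (telescopeTerm j L -ˢ telescopeTerm (suc j) L)
  step = ≈-trans (-ˢ-cong (*-cong rL he) (*-cong rM uLe))
        (≈-trans (telescope-core Ω q D E v1 v2 (invˢ-inverseʳ (evenFactor (suc t)) refl) h2 up)
          (≈-sym (-ˢ-cong Gj Gj1)))
    where
    h2 : ((1ˢ -ˢ q *ˢ D *ˢ (q *ˢ D *ˢ E)) *ˢ v2) ≈ 1ˢ
    h2 = ≈-trans (*-cong (≈-sym u2e) (refl≈ v2)) (invˢ-inverseʳ (evenFactor (suc (M + j))) refl)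
    up : ConstOne ((1ˢ -ˢ E) *ˢ (1ˢ -ˢ q *ˢ D *ˢ (q *ˢ D *ˢ E)))
    up = ConstOne-* (1ˢ -ˢ E) (1ˢ -ˢ q *ˢ D *ˢ (q *ˢ D *ˢ E)) refl (ConstOne-1- (q *ˢ D *ˢ (q *ˢ D *ˢ E)) (NoConst-* (q *ˢ D) (q *ˢ D *ˢ E) (NoConst-* q D refl)))

telescope-last : ∀ M → (weight (suc M) (suc M) *ˢ oddFactor M) ≈ telescopeTerm (suc M) (suc M)
telescope-last M = begin
    weight L L *ˢ h ≈⟨ *-cong (*-cong (*-cong (*-cong (*-cong (refl≈ (s *ˢ Y)) (+-cong (refl≈ 1ˢ) (refl≈ Z))) (*-cong (pochEven-snoc M) (pochEven-snoc M))) (≈-trans (invPochEven-≡ (ℕP.n∸n≡0 L)) invˢ-1)) (invPochEven-snoc (M + suc M))) (refl≈ h) ⟩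
    s *ˢ Y *ˢ (1ˢ +ˢ Z) *ˢ ((BM *ˢ (1ˢ -ˢ Z)) *ˢ (BM *ˢ (1ˢ -ˢ Z))) *ˢ 1ˢ *ˢ (iB′ *ˢ w) *ˢ h
      ≈⟨ solve 7 (λ s Y Z BM iB′ w h → s ⊗ Y ⊗ (one ⊕ Z) ⊗ ((BM ⊗ (one ⊖ Z)) ⊗ (BM ⊗ (one ⊖ Z))) ⊗ one ⊗ (iB′ ⊗ w) ⊗ h
             ⊜ (s ⊗ Y ⊗ one ⊗ h ⊗ ((BM ⊗ (one ⊖ Z)) ⊗ BM) ⊗ one ⊗ iB′) ⊗ ((one ⊖ Z ⊗ Z) ⊗ w)) ≈-refl s Y Z BM iB′ w h ⟩
    K0 *ˢ ((1ˢ -ˢ Z *ˢ Z) *ˢ w) ≈⟨ *-cong (refl≈ K0) (≈-trans (*-cong (≈-sym (-ˢ-cong (refl≈ 1ˢ) (≈-trans (X^-≡ (e₁ M)) (X^-+ (2 * L) (2 * L))))) (refl≈ w)) (invˢ-inverseʳ (evenFactor (suc (M + suc M))) refl)) ⟩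
    K0 *ˢ 1ˢ ≈⟨ *-identityʳ K0 ⟩
    K0 ≈⟨ *-cong (*-cong (*-cong (*-cong (*-cong (refl≈ (s *ˢ Y)) (≈-sym (≈-trans (X^-≡ (cong (_*_ 2) (ℕP.n∸n≡0 L))) X^0))) (+-cong (refl≈ 1ˢ) (X^-≡ (sym (e₂ M)))))
            (*-cong (≈-sym (pochEven-snoc M)) (refl≈ BM))) (≈-sym (≈-trans (invPochEven-≡ (ℕP.n∸n≡0 L)) invˢ-1))) (refl≈ iB′) ⟩
    telescopeTerm L L ∎
  where
  open ≈-Reasoning
  L : ℕ
  Z s Y h BM iB′ w K0 : Series
  L = suc M
  Z = X^ (2 * L)
  s = sign L
  Y = X^ (L * (2 * L ∸ 1))
  h = oddFactor M
  BM = pochEven M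
  iB′ = invˢ (pochEven (M + suc M))
  w = invˢ (evenFactor (suc (M + suc M)))
  K0 = s *ˢ Y *ˢ 1ˢ *ˢ h *ˢ ((BM *ˢ (1ˢ -ˢ Z)) *ˢ BM) *ˢ 1ˢ *ˢ iB′
  e₁ : ∀ M → 2 * suc (M + suc M) ≡ 2 * suc M + 2 * suc M
  e₁ = ℕSolver.solve-∀
  e₂ : ∀ M → M + suc (M + 0) ≡ suc (2 * M)
  e₂ = ℕSolver.solve-∀

telescope-first : ∀ M → (oddFactor M -ˢ evenFactor (suc M)) ≈ negˢ (telescopeTerm 1 (suc M))
telescope-first M = begin
    oddFactor M -ˢ evenFactor L ≈⟨ -ˢ-cong (+-cong (refl≈ 1ˢ) (X^-+ 1 (2 * M))) (-ˢ-cong (refl≈ 1ˢ) (≈-trans (X^-≡ (e₃ M)) (≈-trans (X^-+ 1 (1 + 2 * M)) (*-cong (refl≈ q) (X^-+ 1 (2 * M)))))) ⟩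
    (1ˢ +ˢ q *ˢ X2M) -ˢ (1ˢ -ˢ q *ˢ (q *ˢ X2M))
      ≈⟨ solve 2 (λ q X → (one ⊕ q ⊗ X) ⊖ (one ⊖ q ⊗ (q ⊗ X)) ⊜ ⊝ ((⊝ one ⊗ one ⊗ q ⊗ X ⊗ (one ⊕ q)) ⊗ one ⊗ one)) ≈-refl q X2M ⟩
    negˢ (K1 *ˢ 1ˢ *ˢ 1ˢ) ≈⟨ -‿cong (*-cong (*-cong (refl≈ K1) (≈-sym (invˢ-inverseʳ (pochEven M) (pochEven-ConstOne M)))) (≈-sym (invˢ-inverseʳ (pochEven L) (pochEven-ConstOne L)))) ⟩
    negˢ (K1 *ˢ (BM *ˢ invˢ BM) *ˢ (pochEven L *ˢ invˢ (pochEven L)))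
      ≈⟨ -‿cong (solve 5 (λ K1 BM iBM BL iBL → K1 ⊗ (BM ⊗ iBM) ⊗ (BL ⊗ iBL) ⊜ K1 ⊗ (BL ⊗ BM) ⊗ iBM ⊗ iBL) ≈-refl K1 BM (invˢ BM) (pochEven L) (invˢ (pochEven L))) ⟩
    negˢ (K1 *ˢ (pochEven L *ˢ BM) *ˢ invˢ BM *ˢ invˢ (pochEven L)) ≈⟨ -‿cong (*-cong (refl≈ (K1 *ˢ (pochEven L *ˢ BM) *ˢ invˢ BM)) (invPochEven-≡ (ℕP.+-comm 1 M))) ⟩
    negˢ (telescopeTerm 1 L) ∎
  where
  open ≈-Reasoning
  L : ℕ
  X2M BM K1 : Series
  L = suc M
  X2M = X^ (2 * M)
  BM = pochEven M
  K1 = sign 1 *ˢ q *ˢ X2M *ˢ (1ˢ +ˢ q)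
  e₃ : ∀ M → 2 * suc M ≡ 1 + (1 + 2 * M)
  e₃ = ℕSolver.solve-∀

telescopeTerm-step : ∀ M j → 1 ≤ j → j ≤ M →
  (weight j (suc M) *ˢ oddFactor M -ˢ weight j M *ˢ evenFactor (suc M)) ≈ (telescopeTerm j (suc M) -ˢ telescopeTerm (suc j) (suc M))
telescopeTerm-step M (suc i) _ le =
  subst (λ M → (weight (suc i) (suc M) *ˢ oddFactor M -ˢ weight (suc i) M *ˢ evenFactor (suc M))
                 ≈ (telescopeTerm (suc i) (suc M) -ˢ telescopeTerm (suc (suc i)) (suc M)))
        (ℕP.m+[n∸m]≡n le) (TelescopeStep.step i (M ∸ suc i))

expansion-step : ∀ M → ((1ˢ +ˢ rangeSum (λ j → weight j (suc M)) 1 (suc M)) *ˢ oddFactor M) ≈ (evenFactor (suc M) *ˢ (1ˢ +ˢ rangeSum (λ j → weight j M) 1 M))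
expansion-step M = ≈-from-difference _ _ (begin
    (1ˢ +ˢ rangeSum (λ j → weight j L) 1 L) *ˢ h -ˢ uL *ˢ (1ˢ +ˢ SM) ≈⟨ -ˢ-cong (*-cong (+-cong (refl≈ 1ˢ) (rangeSum-snoc (λ j → weight j L) 1 M (s≤s z≤n))) (refl≈ h)) (refl≈ (uL *ˢ (1ˢ +ˢ SM))) ⟩
    (1ˢ +ˢ (SL' +ˢ rLL)) *ˢ h -ˢ uL *ˢ (1ˢ +ˢ SM)
      ≈⟨ solve 5 (λ h uL SL' SM rLL → (one ⊕ (SL' ⊕ rLL)) ⊗ h ⊖ uL ⊗ (one ⊕ SM) ⊜ (h ⊖ uL) ⊕ (SL' ⊗ h ⊖ SM ⊗ uL) ⊕ rLL ⊗ h) ≈-refl h uL SL' SM rLL ⟩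
    (h -ˢ uL) +ˢ (SL' *ˢ h -ˢ SM *ˢ uL) +ˢ rLL *ˢ h ≈⟨ +-cong (+-cong (telescope-first M) lin) (telescope-last M) ⟩
    negˢ (telescopeTerm 1 L) +ˢ (telescopeTerm 1 L -ˢ telescopeTerm L L) +ˢ telescopeTerm L L ≈⟨ solve 2 (λ a b → ⊝ a ⊕ (a ⊖ b) ⊕ b ⊜ Κ (+ 0)) ≈-refl (telescopeTerm 1 L) (telescopeTerm L L) ⟩
    0ˢ ∎)
  where
  open ≈-Reasoning
  L : ℕ
  h uL SL' SM rLL : Series
  L = suc M
  h = oddFactor M
  uL = evenFactor L
  SL' = rangeSum (λ j → weight j L) 1 M
  SM = rangeSum (λ j → weight j M) 1 M
  rLL = weight L L
  lin : (SL' *ˢ h -ˢ SM *ˢ uL) ≈ (telescopeTerm 1 L -ˢ telescopeTerm L L)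
  lin = ≈-trans (≈-sym (≈-trans (rangeSum-- (λ j → weight j L *ˢ h) (λ j → weight j M *ˢ uL) 1 M) (-ˢ-cong (rangeSum-scaleʳ (λ j → weight j L) h 1 M) (rangeSum-scaleʳ (λ j → weight j M) uL 1 M))))
         (≈-trans (rangeSum-cong (λ j → weight j L *ˢ h -ˢ weight j M *ˢ uL) (λ j → telescopeTerm j L -ˢ telescopeTerm (suc j) L) 1 M (λ j l1 l2 → telescopeTerm-step M j l1 l2))
           (telescope (λ j → telescopeTerm j L) M))

-- The finite expansion  (q²;q²)_M / (-q;q²)_M = 1 + Σ_{1 ≤ j ≤ M} weight j M,
-- by induction on M: both sides acquire the factor (1 - q^{2M+2}) / (1 + q^{2M+1}).
pochRatio-expansion : ∀ M → (pochRatio M -ˢ 1ˢ) ≈ rangeSum (λ j → weight j M) 1 M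
pochRatio-expansion zero = ≈-trans (-ˢ-cong (≈-trans (*-cong (refl≈ 1ˢ) invˢ-1) (*-identityˡ 1ˢ)) (refl≈ 1ˢ)) (solve 0 (one ⊖ one ⊜ Κ (+ 0)) ≈-refl)
pochRatio-expansion (suc M) = begin
    pochRatio L -ˢ 1ˢ ≈⟨ -ˢ-cong (pochRatio-snoc M) (refl≈ 1ˢ) ⟩
    pochRatio M *ˢ uL *ˢ ih -ˢ 1ˢ ≈⟨ -ˢ-cong (*-cong (*-cong ccM (refl≈ uL)) (refl≈ ih)) (refl≈ 1ˢ) ⟩
    (1ˢ +ˢ SM) *ˢ uL *ˢ ih -ˢ 1ˢ ≈⟨ -ˢ-cong (*-cong (≈-trans (*-comm (1ˢ +ˢ SM) uL) (≈-sym (expansion-step M))) (refl≈ ih)) (refl≈ 1ˢ) ⟩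
    (1ˢ +ˢ SL) *ˢ h *ˢ ih -ˢ 1ˢ ≈⟨ -ˢ-cong (≈-trans (*-assoc (1ˢ +ˢ SL) h ih) (*-cong (refl≈ (1ˢ +ˢ SL)) (invˢ-inverseʳ h refl))) (refl≈ 1ˢ) ⟩
    (1ˢ +ˢ SL) *ˢ 1ˢ -ˢ 1ˢ ≈⟨ solve 1 (λ a → (one ⊕ a) ⊗ one ⊖ one ⊜ a) ≈-refl SL ⟩
    SL ∎
  where
  open ≈-Reasoning
  L : ℕ
  h uL ih SM SL : Series
  L = suc M
  h = oddFactor M
  uL = evenFactor L
  ih = invˢ h
  SM = rangeSum (λ j → weight j M) 1 M
  SL = rangeSum (λ j → weight j L) 1 L
  ccM : pochRatio M ≈ (1ˢ +ˢ SM)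
  ccM = ≈-trans (solve 1 (λ a → a ⊜ one ⊕ (a ⊖ one)) ≈-refl (pochRatio M)) (+-cong (refl≈ 1ˢ) (pochRatio-expansion M))

gPow : ℕ → ℕ → Series
gPow j k = powˢ (g j) k

closedForm : ℕ → ℕ → Series
closedForm k M = rangeSum (λ j → weight j M *ˢ gPow j k) 1 M

-- The closed form satisfies the last-index recursion of the excess; termwise
-- this is weight-g-relation, and the new index j = M+1 accounts for the rest.
closedForm-last : ∀ k M → closedForm (suc k) (suc M) ≈ (closedForm (suc k) M +ˢ g (suc M) *ˢ closedForm k (suc M))
closedForm-last k M = ≈-sym (begin
    closedForm (suc k) M +ˢ G *ˢ closedForm k L
      ≈⟨ +-cong (refl≈ (closedForm (suc k) M)) (*-cong (refl≈ G) (rangeSum-snoc φ′ 1 M (s≤s z≤n))) ⟩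
    closedForm (suc k) M +ˢ G *ˢ (rangeSum φ′ 1 M +ˢ φ′ L)
      ≈⟨ solve 4 (λ a G b c → a ⊕ G ⊗ (b ⊕ c) ⊜ (a ⊕ G ⊗ b) ⊕ G ⊗ c) ≈-refl (closedForm (suc k) M) G (rangeSum φ′ 1 M) (φ′ L) ⟩
    (closedForm (suc k) M +ˢ G *ˢ rangeSum φ′ 1 M) +ˢ G *ˢ φ′ L
      ≈⟨ +-cong inner (solve 3 (λ G a b → G ⊗ (a ⊗ b) ⊜ a ⊗ (G ⊗ b)) ≈-refl G (weight L L) (gPow L k)) ⟩
    rangeSum φ 1 M +ˢ φ L
      ≈⟨ ≈-sym (rangeSum-snoc φ 1 M (s≤s z≤n)) ⟩
    closedForm (suc k) L ∎)
  where
  open ≈-Reasoning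
  L : ℕ
  G : Series
  L = suc M
  G = g L
  φ φ′ : ℕ → Series
  φ  j = weight j L *ˢ gPow j (suc k)
  φ′ j = weight j L *ˢ gPow j k
  term : ∀ j → 1 ≤ j → j ≤ M → (weight j M *ˢ gPow j (suc k) +ˢ G *ˢ φ′ j) ≈ φ j
  term j 1≤j j≤M = begin
      weight j M *ˢ (g j *ˢ gPow j k) +ˢ G *ˢ (weight j L *ˢ gPow j k)
        ≈⟨ solve 5 (λ rM gj P gL rL → rM ⊗ (gj ⊗ P) ⊕ gL ⊗ (rL ⊗ P) ⊜ (rM ⊗ gj) ⊗ P ⊕ gL ⊗ (rL ⊗ P))
             ≈-refl (weight j M) (g j) (gPow j k) G (weight j L) ⟩
      (weight j M *ˢ g j) *ˢ gPow j k +ˢ G *ˢ (weight j L *ˢ gPow j k)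
        ≈⟨ +-cong (*-cong (≈-sym (weight-g-relation M j 1≤j j≤M)) (refl≈ (gPow j k))) (refl≈ (G *ˢ φ′ j)) ⟩
      (weight j L *ˢ (g j -ˢ G)) *ˢ gPow j k +ˢ G *ˢ (weight j L *ˢ gPow j k)
        ≈⟨ solve 4 (λ rL gj gL P → (rL ⊗ (gj ⊖ gL)) ⊗ P ⊕ gL ⊗ (rL ⊗ P) ⊜ rL ⊗ (gj ⊗ P)) ≈-refl (weight j L) (g j) G (gPow j k) ⟩
      weight j L *ˢ (g j *ˢ gPow j k) ∎
  inner : (closedForm (suc k) M +ˢ G *ˢ rangeSum φ′ 1 M) ≈ rangeSum φ 1 M
  inner = ≈-trans (+-cong (refl≈ (closedForm (suc k) M)) (≈-sym (rangeSum-scaleˡ G φ′ 1 M)))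
    (≈-trans (≈-sym (rangeSum-+ (λ j → weight j M *ˢ gPow j (suc k)) (λ j → G *ˢ φ′ j) 1 M))
      (rangeSum-cong _ φ 1 M term))

-- The excess in closed form, by induction on M and k: both sides start from
-- the finite expansion (k = 0) and obey the same recursion.
excess-closed-form : ∀ M k → excess k M ≈ closedForm k M
excess-closed-form M       zero    = ≈-trans (pochRatio-expansion M)
  (rangeSum-cong (λ j → weight j M) (λ j → weight j M *ˢ gPow j 0) 1 M (λ j _ _ → ≈-sym (*-identityʳ (weight j M))))
excess-closed-form zero    (suc k) = ≈-refl
excess-closed-form (suc M) (suc k) = ≈-trans (excess-last k M)
  (≈-trans (+-cong (excess-closed-form M (suc k)) (*-cong (refl≈ (g (suc M))) (excess-closed-form (suc M) k)))
           (≈-sym (closedForm-last k M)))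

rhsTerm-factor : ∀ k n → 1 ≤ n → rhsTerm k n ≈ (limitWeight n *ˢ gPow n k)
rhsTerm-factor k (suc i) _ = begin
    rhsTerm k j
      ≈⟨ *-cong (*-cong (*-cong (refl≈ (sign j)) (≈-trans (X^-≡ exponent) (X^-+ (j * (2 * j ∸ 1)) (k * (2 * j))))) (refl≈ (1ˢ +ˢ A))) inverse ⟩
    sign j *ˢ (Y *ˢ X^ (k * (2 * j))) *ˢ (1ˢ +ˢ A) *ˢ powˢ w k
      ≈⟨ solve 5 (λ s Y Xk Ap P → s ⊗ (Y ⊗ Xk) ⊗ Ap ⊗ P ⊜ s ⊗ Y ⊗ Ap ⊗ (Xk ⊗ P)) ≈-refl (sign j) Y (X^ (k * (2 * j))) (1ˢ +ˢ A) (powˢ w k) ⟩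
    limitWeight j *ˢ (X^ (k * (2 * j)) *ˢ powˢ w k)
      ≈⟨ *-cong (refl≈ (limitWeight j)) (≈-trans (*-cong (≈-sym (pow-X^ (2 * j) k)) (refl≈ (powˢ w k))) (≈-sym (pow-distrib A w k))) ⟩
    limitWeight j *ˢ gPow j k ∎
  where
  open ≈-Reasoning
  j : ℕ
  A Y w : Series
  j = suc i
  A = X^ (2 * j)
  Y = X^ (j * (2 * j ∸ 1))
  w = invˢ (powˢ (evenFactor j) 2)
  exponent : j * (2 * j ∸ 1) + 2 * k * j ≡ j * (2 * j ∸ 1) + k * (2 * j)
  exponent = cong (_+_ (j * (2 * j ∸ 1)))
    (trans (ℕP.*-assoc 2 k j) (trans (cong (_*_ 2) (ℕP.*-comm k j)) (trans (sym (ℕP.*-assoc 2 j k)) (ℕP.*-comm (2 * j) k))))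
  inverse : invˢ (powˢ (evenFactor j) (2 * k)) ≈ powˢ w k
  inverse = ≈-trans
    (invˢ-cong (powˢ (evenFactor j) (2 * k)) (powˢ (powˢ (evenFactor j) 2) k) (ConstOne-pow (evenFactor j) (2 * k) refl)
      (≈-trans (≈-reflexive (cong (powˢ (evenFactor j)) (ℕP.*-comm 2 k))) (pow-* (evenFactor j) k 2)))
    (invˢ-pow (powˢ (evenFactor j) 2) k (ConstOne-pow (evenFactor j) 2 refl))

VanishesBelow : ℕ → Series → Set
VanishesBelow v a = ∀ n → n < v → a n ≡ + 0

VanishesBelow-cong : ∀ v a b → a ≈ b → VanishesBelow v a → VanishesBelow v b
VanishesBelow-cong v a b e z n lt = trans (sym (e n)) (z n lt)

VanishesBelow-mono : ∀ v w a → v ≤ w → VanishesBelow w a → VanishesBelow v a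
VanishesBelow-mono v w a le z n lt = z n (ℕP.<-≤-trans lt le)

VanishesBelow-+ : ∀ v a b → VanishesBelow v a → VanishesBelow v b → VanishesBelow v (a +ˢ b)
VanishesBelow-+ v a b za zb n lt = cong₂ _+ℤ_ (za n lt) (zb n lt)

VanishesBelow-neg : ∀ v a → VanishesBelow v a → VanishesBelow v (negˢ a)
VanishesBelow-neg v a z n lt = cong -_ (z n lt)

VanishesBelow-X^ : ∀ v → VanishesBelow v (X^ v)
VanishesBelow-X^ (suc v) zero    _        = refl
VanishesBelow-X^ (suc v) (suc n) (s≤s lt) = VanishesBelow-X^ v n lt

-- Valuations add under multiplication: in aᵢ b_{n-i} with n < v + w,
-- either i < v or n - i < w.
VanishesBelow-* : ∀ v w a b → VanishesBelow v a → VanishesBelow w b → VanishesBelow (v + w) (a *ˢ b)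
VanishesBelow-* v w a b za zb n lt = trans (*ˢ-coeff a b n) (Σℤ-zero (λ i → a i *ℤ b (n ∸ i)) (suc n) term)
  where
  term : ∀ i → i < suc n → a i *ℤ b (n ∸ i) ≡ + 0
  term i (s≤s i≤n) with i <? v
  ... | yes i<v = trans (cong (_*ℤ b (n ∸ i)) (za i i<v)) (ℤP.*-zeroˡ (b (n ∸ i)))
  ... | no  i≮v = trans (cong (a i *ℤ_) (zb (n ∸ i) n∸i<w)) (ℤP.*-zeroʳ (a i))
    where
    v≤i : v ≤ i
    v≤i = ℕP.≮⇒≥ i≮v
    n∸i<w : n ∸ i < w
    n∸i<w = ℕP.≤-<-trans (ℕP.∸-mono (ℕP.≤-refl {n}) v≤i)
              (subst (n ∸ v <_) (ℕP.m+n∸m≡n v w) (ℕP.∸-monoˡ-< lt (ℕP.≤-trans v≤i i≤n)))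

VanishesBelow-*ʳ : ∀ v a b → VanishesBelow v a → VanishesBelow v (a *ˢ b)
VanishesBelow-*ʳ v a b z = VanishesBelow-mono v (v + 0) (a *ˢ b) (ℕP.≤-reflexive (sym (ℕP.+-identityʳ v)))
  (VanishesBelow-* v 0 a b z (λ n ()))

VanishesBelow-*ˡ : ∀ v a b → VanishesBelow v b → VanishesBelow v (a *ˢ b)
VanishesBelow-*ˡ v a b z n lt = trans (*ˢ-comm n a b) (VanishesBelow-*ʳ v b a z n lt)

VanishesBelow-Σˢ : ∀ v f n → (∀ i → i < n → VanishesBelow v (f i)) → VanishesBelow v (Σˢ f n)
VanishesBelow-Σˢ v f zero    e k lt = refl
VanishesBelow-Σˢ v f (suc n) e = VanishesBelow-+ v (f 0) (Σˢ (f ∘ suc) n) (e 0 (s≤s z≤n))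
  (VanishesBelow-Σˢ v (f ∘ suc) n (λ i lt → e (suc i) (s≤s lt)))

VanishesBelow-rangeSum : ∀ v f lo hi → (∀ m → lo ≤ m → m ≤ hi → VanishesBelow v (f m)) → VanishesBelow v (rangeSum f lo hi)
VanishesBelow-rangeSum v f lo hi e = VanishesBelow-cong v _ _ (≈-sym (rangeSum-Σˢ f lo hi))
  (VanishesBelow-Σˢ v (λ i → f (lo + i)) (suc hi ∸ lo) (λ i lt → e (lo + i) (ℕP.m≤m+n lo i) (range-bound lo hi i lt)))

pochFrom-1-vanish : ∀ a n → VanishesBelow (2 * suc a) (pochFrom a n -ˢ 1ˢ)
pochFrom-1-vanish a zero    = VanishesBelow-cong _ 0ˢ (1ˢ -ˢ 1ˢ) (solve 0 (Κ (+ 0) ⊜ one ⊖ one) ≈-refl) (λ _ _ → refl)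
pochFrom-1-vanish a (suc n) = VanishesBelow-cong _ ((pochFrom a n -ˢ 1ˢ) *ˢ u +ˢ negˢ x) (pochFrom a (suc n) -ˢ 1ˢ)
  (solve 2 (λ t x → (t ⊖ one) ⊗ (one ⊖ x) ⊕ ⊝ x ⊜ t ⊗ (one ⊖ x) ⊖ one) ≈-refl (pochFrom a n) x)
  (VanishesBelow-+ _ _ _ (VanishesBelow-*ʳ _ (pochFrom a n -ˢ 1ˢ) u (pochFrom-1-vanish a n))
    (VanishesBelow-neg _ _ (VanishesBelow-mono _ _ _ (ℕP.*-monoʳ-≤ 2 (s≤s (ℕP.m≤m+n a n))) (VanishesBelow-X^ (2 * suc (a + n))))))
  where
  x u : Series
  x = X^ (2 * suc (a + n))
  u = evenFactor (suc (a + n))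

-- weight j N ≡ limitWeight j modulo q^{2(N-j+1)}: the two ratios of
-- q-Pochhammer symbols it adds are ≡ 1 to that order.
weight-converges : ∀ N j → j ≤ N → VanishesBelow (2 * suc (N ∸ j)) (weight j N -ˢ limitWeight j)
weight-converges N j le = VanishesBelow-cong _ (limitWeight j *ˢ ((T1 -ˢ 1ˢ) *ˢ iT2 +ˢ negˢ ((T2 -ˢ 1ˢ) *ˢ iT2))) (weight j N -ˢ limitWeight j) difference
  (VanishesBelow-*ˡ _ (limitWeight j) _ (VanishesBelow-+ _ _ _ (VanishesBelow-*ʳ _ (T1 -ˢ 1ˢ) iT2 (pochFrom-1-vanish t j))
     (VanishesBelow-neg _ _ (VanishesBelow-*ʳ _ (T2 -ˢ 1ˢ) iT2
       (VanishesBelow-mono _ _ _ (ℕP.*-monoʳ-≤ 2 (s≤s (ℕP.m∸n≤m N j))) (pochFrom-1-vanish N j))))))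
  where
  open ≈-Reasoning
  t : ℕ
  T1 T2 iT2 a : Series
  t = N ∸ j
  T1 = pochFrom t j
  T2 = pochFrom N j
  iT2 = invˢ T2
  a = limitWeight j
  BN : pochEven N ≈ (pochEven t *ˢ T1)
  BN = ≈-trans (pochEven-≡ (sym (ℕP.m∸n+n≡m le))) (pochEven-split t j)
  iBNj : invˢ (pochEven (N + j)) ≈ (invˢ (pochEven N) *ˢ iT2)
  iBNj = ≈-trans (invˢ-cong (pochEven (N + j)) (pochEven N *ˢ T2) (pochEven-ConstOne (N + j)) (pochEven-split N j))
    (invˢ-* (pochEven N) T2 (pochEven-ConstOne N) (pochFrom-ConstOne N j))
  difference : (a *ˢ ((T1 -ˢ 1ˢ) *ˢ iT2 +ˢ negˢ ((T2 -ˢ 1ˢ) *ˢ iT2))) ≈ (weight j N -ˢ a)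
  difference = ≈-sym (begin
      weight j N -ˢ a
        ≈⟨ -ˢ-cong (*-cong (refl≈ (a *ˢ (pochEven N *ˢ pochEven N) *ˢ invˢ (pochEven t))) iBNj) (refl≈ a) ⟩
      a *ˢ (pochEven N *ˢ pochEven N) *ˢ invˢ (pochEven t) *ˢ (invˢ (pochEven N) *ˢ iT2) -ˢ a
        ≈⟨ -ˢ-cong (*-cong (*-cong (*-cong (refl≈ a) (*-cong BN (refl≈ (pochEven N)))) (refl≈ (invˢ (pochEven t))))
                           (refl≈ (invˢ (pochEven N) *ˢ iT2))) (refl≈ a) ⟩
      a *ˢ ((pochEven t *ˢ T1) *ˢ pochEven N) *ˢ invˢ (pochEven t) *ˢ (invˢ (pochEven N) *ˢ iT2) -ˢ a
        ≈⟨ solve 7 (λ a Bt T1 BN iBt iBN iT2 → a ⊗ ((Bt ⊗ T1) ⊗ BN) ⊗ iBt ⊗ (iBN ⊗ iT2) ⊖ a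
              ⊜ a ⊗ (T1 ⊗ iT2) ⊗ ((Bt ⊗ iBt) ⊗ (BN ⊗ iBN)) ⊖ a)
             ≈-refl a (pochEven t) T1 (pochEven N) (invˢ (pochEven t)) (invˢ (pochEven N)) iT2 ⟩
      a *ˢ (T1 *ˢ iT2) *ˢ ((pochEven t *ˢ invˢ (pochEven t)) *ˢ (pochEven N *ˢ invˢ (pochEven N))) -ˢ a
        ≈⟨ -ˢ-cong (*-cong (refl≈ (a *ˢ (T1 *ˢ iT2)))
                      (≈-trans (*-cong (invˢ-inverseʳ (pochEven t) (pochEven-ConstOne t)) (invˢ-inverseʳ (pochEven N) (pochEven-ConstOne N))) (*-identityˡ 1ˢ)))
                   (≈-sym (≈-trans (*-cong (refl≈ a) (invˢ-inverseʳ T2 (pochFrom-ConstOne N j))) (*-identityʳ a))) ⟩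
      a *ˢ (T1 *ˢ iT2) *ˢ 1ˢ -ˢ a *ˢ (T2 *ˢ iT2)
        ≈⟨ solve 4 (λ a T1 T2 iT2 → a ⊗ (T1 ⊗ iT2) ⊗ one ⊖ a ⊗ (T2 ⊗ iT2) ⊜ a ⊗ ((T1 ⊖ one) ⊗ iT2 ⊕ ⊝ ((T2 ⊖ one) ⊗ iT2)))
             ≈-refl a T1 T2 iT2 ⟩
      a *ˢ ((T1 -ˢ 1ˢ) *ˢ iT2 +ˢ negˢ ((T2 -ˢ 1ˢ) *ˢ iT2)) ∎)

gPow-vanish : ∀ j k → VanishesBelow (2 * j) (gPow j (suc k))
gPow-vanish j k = VanishesBelow-*ʳ _ (g j) (gPow j k)
  (VanishesBelow-*ʳ _ (X^ (2 * j)) (invˢ (powˢ (evenFactor j) 2)) (VanishesBelow-X^ (2 * j)))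

-- (weight j N - limitWeight j) (g j)^{k+1} is divisible by q^{2(N-j+1)+2j}, hence by q^{N+1}.
weight-error-term : ∀ N k j → j ≤ N → VanishesBelow (suc N) ((weight j N -ˢ limitWeight j) *ˢ gPow j (suc k))
weight-error-term N k j le = VanishesBelow-mono _ _ _ bound
  (VanishesBelow-* _ _ (weight j N -ˢ limitWeight j) (gPow j (suc k)) (weight-converges N j le) (gPow-vanish j k))
  where
  e₀ : ∀ t j → 2 * suc t + 2 * j ≡ suc (suc (t + j + (t + j + 0)))
  e₀ = ℕSolver.solve-∀
  e : 2 * suc (N ∸ j) + 2 * j ≡ suc (suc (N + (N + 0)))
  e = trans (e₀ (N ∸ j) j) (cong (λ z → suc (suc (z + (z + 0)))) (ℕP.m∸n+n≡m le))
  bound : suc N ≤ 2 * suc (N ∸ j) + 2 * j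
  bound = subst (suc N ≤_) (sym e) (s≤s (ℕP.≤-trans (ℕP.m≤m+n N (N + 0)) (ℕP.n≤1+n _)))

closedForm-coeff : ∀ k N → closedForm (suc k) N N ≡ rangeSum (λ j → limitWeight j *ˢ gPow j (suc k)) 1 N N
closedForm-coeff k N = ℤP.i-j≡0⇒i≡j _ _ (trans (difference N)
  (VanishesBelow-rangeSum (suc N) (λ j → (weight j N -ˢ limitWeight j) *ˢ gPow j (suc k)) 1 N
    (λ j _ j≤N → weight-error-term N k j j≤N) N (ℕP.n<1+n N)))
  where
  difference : (closedForm (suc k) N -ˢ rangeSum (λ j → limitWeight j *ˢ gPow j (suc k)) 1 N)
               ≈ rangeSum (λ j → (weight j N -ˢ limitWeight j) *ˢ gPow j (suc k)) 1 N
  difference = ≈-trans (≈-sym (rangeSum-- (λ j → weight j N *ˢ gPow j (suc k)) (λ j → limitWeight j *ˢ gPow j (suc k)) 1 N))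
    (rangeSum-cong _ _ 1 N (λ j _ _ → solve 3 (λ a b c → a ⊗ c ⊖ b ⊗ c ⊜ (a ⊖ b) ⊗ c) ≈-refl (weight j N) (limitWeight j) (gPow j (suc k))))

corollary2p4 : (k : ℕ) → 1 ≤ k → (N : ℕ) →
  chainSum lhsTerm k N ≡ (chainSum prodG k +ˢ sum≥1 (rhsTerm k)) N
corollary2p4 (suc k) _ N = begin
    chainSum lhsTerm (suc k) N
      ≡⟨ sumℤ-coeff lhsTerm (chains (suc k) 1 N) N ⟩
    sumˢ (map lhsTerm (chains (suc k) 1 N)) N
      ≡⟨ lhs-decomposition k N N ⟩
    sumˢ (map prodG (chains (suc k) 1 N)) N +ℤ excess (suc k) N N
      ≡⟨ cong (sumˢ (map prodG (chains (suc k) 1 N)) N +ℤ_) (trans (excess-closed-form N (suc k) N) (closedForm-coeff k N)) ⟩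
    sumˢ (map prodG (chains (suc k) 1 N)) N +ℤ rangeSum (λ j → limitWeight j *ˢ gPow j (suc k)) 1 N N
      ≡⟨ cong₂ _+ℤ_ (sym (sumℤ-coeff prodG (chains (suc k) 1 N) N)) (sym rhs-coeff) ⟩
    (chainSum prodG (suc k) +ˢ sum≥1 (rhsTerm (suc k))) N ∎
  where
  open ≡-Reasoning
  rhs-coeff : sum≥1 (rhsTerm (suc k)) N ≡ rangeSum (λ j → limitWeight j *ˢ gPow j (suc k)) 1 N N
  rhs-coeff = trans (sumℤ-coeff (rhsTerm (suc k)) (range 1 N) N)
    (rangeSum-cong (rhsTerm (suc k)) _ 1 N (λ j 1≤j _ → rhsTerm-factor (suc k) j 1≤j) N)
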